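{- Let $n,d\ge 2$ and $m$ be positive integers such that $m(2^d-1)<(n-1)d$. For every sufficiently large prime power $q$ there exists $T\in\mathrm{Hom}^d(\mathbb{F}_q^{n+1},\mathbb{F}_q^m)$ such that \[ |D_T|\le q^{ -m2^d}\frac{(q^{n+1}-1)^d(q^{n+1}-q)^d}{(q^2-1)^d(q^2-q)^d}\;\big(=(1+o(1))q^{2(n-1)d-m2^d} \text{ as } q\to\infty\big). \]
   Context: $\mathrm{Hom}^d(\mathbb{F}_q^{n+1},\mathbb{F}_q^m)$ is the space of $d$-linear maps $(\mathbb{F}_q^{n+1})^d\to\mathbb{F}_q^m$. $D_T$ is the set of $d$-tuples $(\mathbb{V}_1,\dots,\mathbb{V}_d)$ of $2$-dimensional subspaces of $\mathbb{F}_q^{n+1}$ such that $T(v_1,\dots,v_d)=0$ for all $(v_1,\dots,v_d)\in\mathbb{V}_1\times\cdots\times\mathbb{V}_d$. -}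

module Defs where

open import Level using (0ℓ)
open import Data.Nat as ℕ using (ℕ; _^_; _∸_; _≤_)
open import Data.Fin using (Fin)
open import Data.Vec using (Vec; lookup; zipWith; map; replicate; _[_]≔_)
open import Data.Product using (Σ; _×_; ∃; ∃-syntax; proj₁; _,_)
open import Data.Bool using (Bool; true)
open import Relation.Binary.PropositionalEquality using (_≡_; _≢_)
open import Relation.Nullary using (¬_)
open import Algebra.Structures using (IsCommutativeRing)
open import Function.Bundles using (_↔_)

record FiniteField (q : ℕ) : Set₁ where
  infixl 6 _+_
  infixl 7 _*_
  field
    Carrier : Set
    _+_ _*_ : Carrier → Carrier → Carrier
    -_ : Carrier → Carrier
    0# 1# : Carrier
    isCommutativeRing : IsCommutativeRing _≡_ _+_ _*_ -_ 0# 1#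
    0≢1 : 0# ≢ 1#
    inverse : ∀ x → x ≢ 0# → ∃[ y ] (x * y ≡ 1#)
    card : Fin q ↔ Carrier

module _ {q : ℕ} (F : FiniteField q) where
  open FiniteField F

  Vecᶠ : ℕ → Set
  Vecᶠ k = Vec Carrier k

  0ᵛ : ∀ {k} → Vecᶠ k
  0ᵛ = replicate _ 0#

  _+ᵛ_ : ∀ {k} → Vecᶠ k → Vecᶠ k → Vecᶠ k
  _+ᵛ_ = zipWith _+_

  _·ᵛ_ : ∀ {k} → Carrier → Vecᶠ k → Vecᶠ k
  a ·ᵛ v = map (a *_) v

  IsMultilinear : (d k m : ℕ) → (Vec (Vecᶠ k) d → Vecᶠ m) → Set
  IsMultilinear d k m T =
    ∀ (vs : Vec (Vecᶠ k) d) (i : Fin d) (a : Carrier) (u w : Vecᶠ k) →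
      T (vs [ i ]≔ ((a ·ᵛ u) +ᵛ w)) ≡ (a ·ᵛ T (vs [ i ]≔ u)) +ᵛ T (vs [ i ]≔ w)

  Hom : (d k m : ℕ) → Set
  Hom d k m = Σ (Vec (Vecᶠ k) d → Vecᶠ m) (IsMultilinear d k m)

  Is2DimSubspace : (k : ℕ) → (Vecᶠ k → Bool) → Set
  Is2DimSubspace k V =
    Σ (Vecᶠ k) λ u → Σ (Vecᶠ k) λ w →
      (∀ a b → (a ·ᵛ u) +ᵛ (b ·ᵛ w) ≡ 0ᵛ → (a ≡ 0#) × (b ≡ 0#)) ×
      (∀ x → (V x ≡ true → ∃[ a ] ∃[ b ] (x ≡ (a ·ᵛ u) +ᵛ (b ·ᵛ w))) ×
             ((∃[ a ] ∃[ b ] (x ≡ (a ·ᵛ u) +ᵛ (b ·ᵛ w))) → V x ≡ true))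

  Sub2 : ℕ → Set
  Sub2 k = Σ (Vecᶠ k → Bool) (Is2DimSubspace k)

  _≈S_ : ∀ {k} → Sub2 k → Sub2 k → Set
  VV ≈S WW = ∀ x → proj₁ VV x ≡ proj₁ WW x

  D : ∀ {d k m} → Hom d k m → Set
  D {d} {k} {m} (T , _) =
    Σ (Fin d → Sub2 k) λ Vs →
      ∀ (vs : Vec (Vecᶠ k) d) →
        (∀ i → proj₁ (Vs i) (lookup vs i) ≡ true) →
        T vs ≡ 0ᵛ

  _≈D_ : ∀ {d k m} {T : Hom d k m} → D T → D T → Set
  _≈D_ {d} x y = ∀ (i : Fin d) → proj₁ x i ≈S proj₁ y i

  CardD≤ : ∀ {d k m} (T : Hom d k m) → ℕ → Set
  CardD≤ T B = Σ (D T → Fin B) λ f → ∀ x y → f x ≡ f y → _≈D_ {T = T} x y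

{-# OPTIONS --safe #-}
-- A first-moment argument.  Write k = n + 1 and describe T by m coefficient tensors in
-- F^(k^d).  For a fixed d-tuple of planes V₁, …, V_d, vanishing of T on V₁ × ⋯ × V_d consists of
-- m·2^d independent linear conditions, so at most a q^(−m·2^d) fraction of all T satisfy it;
-- this is proved by induction on d through an explicit injection rather than by linear algebra.
-- Averaging over T the number of d-tuples of ordered bases (independent pairs) spanning planes
-- on which T vanishes yields a T with at most ((q^k − 1)(q^k − q))^d · q^(−m·2^d) of them.
-- Every d-tuple of planes has exactly ((q² − 1)(q² − q))^d ordered bases, the orbit of any one of
-- them under GL₂(F_q)^d, which bounds |D_T|.

module Submission where

open import Defs
open import Level using (0ℓ)
open import Data.Nat as ℕ using (ℕ; zero; suc; _^_; _∸_; _≤_)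
import Data.Nat.Properties as ℕ
open import Data.Nat.Tactic.RingSolver using (solve-∀)
open import Data.Bool using (true)
open import Data.Bool.Properties using (⇔→≡)
open import Data.Empty using (⊥-elim)
open import Data.Fin as Fin using (Fin)
import Data.Fin.Properties as Fin
open import Data.List as List using (List; []; _∷_; _++_; length; map; filter; cartesianProduct)
open import Data.List.Properties using (length-++; length-map; length-tabulate; filter-++; filter-≐; filter-none; filter-all)
open import Data.List.Membership.Propositional using (_∈_; find)
open import Data.List.Membership.Propositional.Properties
  using (∈-allFin; ∈-map⁺; ∈-cartesianProduct⁺; ∈-cartesianProduct⁻; ∈-filter⁺; ∈-filter⁻; ∈-lookup)
import Data.List.Membership.Setoid.Properties as SetoidMembership
open import Data.List.Relation.Unary.Any as Any using (here; there)
open import Data.List.Relation.Unary.Any.Properties using (lookup-index)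
open import Data.List.Relation.Unary.All as All using (All)
open import Data.List.Relation.Unary.AllPairs using ([]; _∷_)
open import Data.List.Relation.Unary.Unique.Propositional using (Unique)
import Data.List.Relation.Unary.Unique.Propositional.Properties as Unique
open import Data.Vec as Vec using (Vec; []; _∷_; lookup; replicate; zipWith; tabulate; _[_]≔_)
open import Data.Vec.Properties
  using (∷-injective; ≡-dec; lookup-replicate; lookup-map; lookup-zipWith; lookup∘update; lookup∘update′; lookup∘tabulate)
open import Data.Vec.Relation.Binary.Pointwise.Extensional using (ext; Pointwise-≡⇒≡)
import Data.Vec.Relation.Unary.All as VecAll
open import Data.Vec.Relation.Unary.All.Properties using (lookup⁺; lookup⁻)
open import Data.Product using (_×_; _,_; proj₁; proj₂; ∃; ∃-syntax; uncurry; swap)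
import Data.Product.Properties as Product
open import Function using (id; _∘_; _$_)
open import Function.Bundles using (Inverse; mk⇔)
open import Relation.Nullary using (¬_; Dec; yes; no; _×-dec_; _→-dec_; ¬?; map′)
open import Relation.Nullary.Decidable using (decidable-stable)
open import Relation.Unary as U using (Pred; _≐_)
open import Relation.Binary.PropositionalEquality
open import Algebra.Bundles using (CommutativeRing)
import Algebra.Properties.AbelianGroup
import Algebra.Properties.Ring
import Algebra.Solver.Ring.NaturalCoefficients.Default
open import Relation.Binary.Definitions using (DecidableEquality)
open import Relation.Binary.Structures using (IsEquivalence)
open import Relation.Binary.PropositionalEquality.Properties using (setoid)

≡-pointwise : ∀ {A : Set} {n} {u v : Vec A n} → (∀ i → lookup u i ≡ lookup v i) → u ≡ v
≡-pointwise u≗v = Pointwise-≡⇒≡ (ext u≗v)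

module Counting where
  open import Data.Nat using (_+_; _*_; _^_; _∸_; _≤_; _<_; z≤n)
  open import Algebra.Properties.CommutativeSemigroup ℕ.+-commutativeSemigroup using () renaming (interchange to +-interchange)

  private variable
    A B : Set

  Complete : List A → Set
  Complete xs = ∀ x → x ∈ xs

  record Enumeration (A : Set) : Set where
    field
      elements : List A
      unique   : Unique elements
      complete : Complete elements

    size : ℕ
    size = length elements

  count : {P : Pred A 0ℓ} → U.Decidable P → List A → ℕ
  count P? xs = length (filter P? xs)

  ∑ : List A → (A → ℕ) → ℕ
  ∑ []       f = 0
  ∑ (x ∷ xs) f = f x + ∑ xs f

  syntax ∑ xs (λ x → e) = ∑[ x ← xs ] e

  module _ {P : Pred A 0ℓ} (P? : U.Decidable P) where

    count-≐ : {Q : Pred A 0ℓ} (Q? : U.Decidable Q) → P ≐ Q → ∀ xs → count P? xs ≡ count Q? xs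
    count-≐ Q? P≐Q xs = cong length (filter-≐ P? Q? P≐Q xs)

    count-++ : ∀ xs ys → count P? (xs ++ ys) ≡ count P? xs + count P? ys
    count-++ xs ys = trans (cong length (filter-++ P? xs ys)) (length-++ (filter P? xs))

    count-map : (f : B → A) → ∀ xs → count P? (map f xs) ≡ count (P? ∘ f) xs
    count-map f []       = refl
    count-map f (x ∷ xs) with P? (f x)
    ... | yes _ = cong suc (count-map f xs)
    ... | no  _ = count-map f xs

    count-all : ∀ {xs} → All P xs → count P? xs ≡ length xs
    count-all Ps = cong length (filter-all P? Ps)

    count-none : ∀ {xs} → All (¬_ ∘ P) xs → count P? xs ≡ 0
    count-none ¬Ps = cong length (filter-none P? ¬Ps)

    count+count-¬ : ∀ xs → count P? xs + count (¬? ∘ P?) xs ≡ length xs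
    count+count-¬ []       = refl
    count+count-¬ (x ∷ xs) with P? x
    ... | yes _ = cong suc (count+count-¬ xs)
    ... | no  _ = trans (ℕ.+-suc _ _) (cong suc (count+count-¬ xs))

    count-¬ : ∀ xs → count (¬? ∘ P?) xs ≡ length xs ∸ count P? xs
    count-¬ xs = trans (sym (ℕ.m+n∸m≡n (count P? xs) _)) (cong (_∸ count P? xs) (count+count-¬ xs))

    count-as-∑ : ∀ xs → count P? xs ≡ ∑[ x ← xs ] count P? (x ∷ [])
    count-as-∑ []       = refl
    count-as-∑ (x ∷ xs) = trans (count-++ (x ∷ []) xs) (cong (count P? (x ∷ []) +_) (count-as-∑ xs))

    ∑-indicator : ∀ xs {f : A → ℕ} {c} → (∀ {x} → P x → f x ≡ c) → (∀ {x} → ¬ P x → f x ≡ 0) →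
                  ∑ xs f ≡ count P? xs * c
    ∑-indicator []       P⇒c ¬P⇒0 = refl
    ∑-indicator (x ∷ xs) P⇒c ¬P⇒0 with P? x
    ... | yes Px = cong₂ _+_ (P⇒c Px) (∑-indicator xs P⇒c ¬P⇒0)
    ... | no ¬Px = trans (cong₂ _+_ (¬P⇒0 ¬Px) refl) (∑-indicator xs P⇒c ¬P⇒0)

    ∑-≤-indicator : ∀ xs {f : A → ℕ} {c} → (∀ {x} → P x → f x ≤ c) → (∀ {x} → ¬ P x → f x ≡ 0) →
                    ∑ xs f ≤ count P? xs * c
    ∑-≤-indicator []       P⇒≤c ¬P⇒0 = z≤n
    ∑-≤-indicator (x ∷ xs) P⇒≤c ¬P⇒0 with P? x
    ... | yes Px = ℕ.+-mono-≤ (P⇒≤c Px) (∑-≤-indicator xs P⇒≤c ¬P⇒0)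
    ... | no ¬Px rewrite ¬P⇒0 ¬Px = ∑-≤-indicator xs P⇒≤c ¬P⇒0

  count-≟ : (_≟_ : DecidableEquality A) → ∀ {xs a} → Unique xs → a ∈ xs → count (_≟ a) xs ≡ 1
  count-≟ _≟_ {x ∷ xs} (x∉xs ∷ _) (here refl) with x ≟ x
  ... | yes _   = cong suc (count-none (_≟ x) (All.map (_∘ sym) x∉xs))
  ... | no x≢x = ⊥-elim (x≢x refl)
  count-≟ _≟_ {x ∷ xs} {a} (x∉xs ∷ uniq) (there a∈xs) with x ≟ a
  ... | yes refl = ⊥-elim (All.lookup x∉xs a∈xs refl)
  ... | no  _    = count-≟ _≟_ uniq a∈xs

  ∑-cong : ∀ xs {f g : A → ℕ} → (∀ x → f x ≡ g x) → ∑ xs f ≡ ∑ xs g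
  ∑-cong []       f≗g = refl
  ∑-cong (x ∷ xs) f≗g = cong₂ _+_ (f≗g x) (∑-cong xs f≗g)

  ∑-mono-≤ : ∀ xs {f g : A → ℕ} → (∀ {x} → x ∈ xs → f x ≤ g x) → ∑ xs f ≤ ∑ xs g
  ∑-mono-≤ []       f≤g = z≤n
  ∑-mono-≤ (x ∷ xs) f≤g = ℕ.+-mono-≤ (f≤g (here refl)) (∑-mono-≤ xs (f≤g ∘ there))

  ∑-const : ∀ xs (c : ℕ) → ∑ xs (λ (_ : A) → c) ≡ length xs * c
  ∑-const []       c = refl
  ∑-const (x ∷ xs) c = cong (c +_) (∑-const xs c)

  ∑-+ : ∀ xs (f g : A → ℕ) → ∑[ x ← xs ] (f x + g x) ≡ ∑ xs f + ∑ xs g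
  ∑-+ []       f g = refl
  ∑-+ (x ∷ xs) f g = trans (cong (f x + g x +_) (∑-+ xs f g)) (+-interchange (f x) (g x) (∑ xs f) _)

  ∑-*ʳ : ∀ xs (f : A → ℕ) c → ∑[ x ← xs ] (f x * c) ≡ ∑ xs f * c
  ∑-*ʳ []       f c = refl
  ∑-*ʳ (x ∷ xs) f c = trans (cong (f x * c +_) (∑-*ʳ xs f c)) (sym (ℕ.*-distribʳ-+ c (f x) (∑ xs f)))

  module _ {R : A → B → Set} (R? : ∀ x y → Dec (R x y)) where

    ∑-count-comm : ∀ xs ys → ∑[ x ← xs ] count (R? x) ys ≡ ∑[ y ← ys ] count (λ x → R? x y) xs
    ∑-count-comm []       ys = sym (trans (∑-const ys 0) (ℕ.*-zeroʳ (length ys)))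
    ∑-count-comm (x ∷ xs) ys = begin
      count (R? x) ys + ∑[ x′ ← xs ] count (R? x′) ys
        ≡⟨ cong₂ _+_ (trans (count-as-∑ (R? x) ys) (∑-cong ys singleton)) (∑-count-comm xs ys) ⟩
      ∑[ y ← ys ] count (λ x′ → R? x′ y) (x ∷ []) + ∑[ y ← ys ] count (λ x′ → R? x′ y) xs
        ≡⟨ sym (∑-+ ys _ _) ⟩
      ∑[ y ← ys ] (count (λ x′ → R? x′ y) (x ∷ []) + count (λ x′ → R? x′ y) xs)
        ≡⟨ ∑-cong ys (λ y → sym (count-++ (λ x′ → R? x′ y) (x ∷ []) xs)) ⟩
      ∑[ y ← ys ] count (λ x′ → R? x′ y) (x ∷ xs) ∎
      where
      open ≡-Reasoning
      singleton : ∀ y → count (R? x) (y ∷ []) ≡ count (λ x′ → R? x′ y) (x ∷ [])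
      singleton y with R? x y
      ... | yes _ = refl
      ... | no  _ = refl

  length-cartesianProduct : (xs : List A) (ys : List B) → length (cartesianProduct xs ys) ≡ length xs * length ys
  length-cartesianProduct []       ys = refl
  length-cartesianProduct (x ∷ xs) ys =
    trans (length-++ (map (x ,_) ys)) (cong₂ _+_ (length-map (x ,_) ys) (length-cartesianProduct xs ys))

  module _ {R : Pred (A × B) 0ℓ} (R? : U.Decidable R) where

    count-cartesianProduct : ∀ xs ys → count R? (cartesianProduct xs ys) ≡ ∑[ x ← xs ] count (λ y → R? (x , y)) ys
    count-cartesianProduct []       ys = refl
    count-cartesianProduct (x ∷ xs) ys =
      trans (count-++ R? (map (x ,_) ys) _) (cong₂ _+_ (count-map R? (x ,_) ys) (count-cartesianProduct xs ys))

  module _ {P : Pred A 0ℓ} {Q : Pred B 0ℓ} (P? : U.Decidable P) (Q? : U.Decidable Q) where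

    count-× : ∀ xs ys → count (λ (xy : A × B) → P? (proj₁ xy) ×-dec Q? (proj₂ xy)) (cartesianProduct xs ys) ≡ count P? xs * count Q? ys
    count-× xs ys = trans (count-cartesianProduct _ xs ys) (∑-indicator P? xs P⇒ ¬P⇒)
      where
      P⇒ : ∀ {x} → P x → count (λ y → P? x ×-dec Q? y) ys ≡ count Q? ys
      P⇒ Px = count-≐ _ Q? (proj₂ , (Px ,_)) ys
      ¬P⇒ : ∀ {x} → ¬ P x → count (λ y → P? x ×-dec Q? y) ys ≡ 0
      ¬P⇒ {x} ¬Px = count-none (λ y → P? x ×-dec Q? y) {ys} (All.tabulate λ _ → ¬Px ∘ proj₁)

  module _ {P : Pred A 0ℓ} (P? : U.Decidable P) where

    count-×ˡ : ∀ xs (ys : List B) → count (P? ∘ proj₁) (cartesianProduct xs ys) ≡ count P? xs * length ys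
    count-×ˡ xs ys = trans (count-cartesianProduct (P? ∘ proj₁) xs ys) $ ∑-indicator P? xs
      (λ {x} Px → count-all (λ _ → P? x) {ys} (All.tabulate λ _ → Px))
      (λ {x} ¬Px → count-none (λ _ → P? x) {ys} (All.tabulate λ _ → ¬Px))

  vectors : ∀ n → List A → List (Vec A n)
  vectors zero    xs = [] ∷ []
  vectors (suc n) xs = map (uncurry _∷_) (cartesianProduct xs (vectors n xs))

  length-vectors : ∀ n (xs : List A) → length (vectors n xs) ≡ length xs ^ n
  length-vectors zero    xs = refl
  length-vectors (suc n) xs = begin
    length (map (uncurry _∷_) (cartesianProduct xs (vectors n xs))) ≡⟨ length-map _ (cartesianProduct xs _) ⟩
    length (cartesianProduct xs (vectors n xs))                      ≡⟨ length-cartesianProduct xs _ ⟩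
    length xs * length (vectors n xs)                                ≡⟨ cong (length xs *_) (length-vectors n xs) ⟩
    length xs * length xs ^ n                                        ∎
    where open ≡-Reasoning

  count-vectors-All : {P : Pred A 0ℓ} (P? : U.Decidable P) → ∀ n xs →
                      count (VecAll.all? P?) (vectors n xs) ≡ count P? xs ^ n
  count-vectors-All P? zero    xs = refl
  count-vectors-All P? (suc n) xs = begin
    count (VecAll.all? P?) (map (uncurry _∷_) (cartesianProduct xs (vectors n xs)))
      ≡⟨ count-map (VecAll.all? P?) (uncurry _∷_) (cartesianProduct xs _) ⟩
    count (VecAll.all? P? ∘ uncurry _∷_) (cartesianProduct xs (vectors n xs))
      ≡⟨ count-≐ _ _ ((λ { (Px VecAll.∷ Pv) → Px , Pv }) , uncurry VecAll._∷_) (cartesianProduct xs _) ⟩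
    count (λ xv → P? (proj₁ xv) ×-dec VecAll.all? P? (proj₂ xv)) (cartesianProduct xs (vectors n xs))
      ≡⟨ count-× P? (VecAll.all? P?) xs (vectors n xs) ⟩
    count P? xs * count (VecAll.all? P?) (vectors n xs)
      ≡⟨ cong (count P? xs *_) (count-vectors-All P? n xs) ⟩
    count P? xs * count P? xs ^ n ∎
    where open ≡-Reasoning

  _×ᴱ_ : Enumeration A → Enumeration B → Enumeration (A × B)
  E ×ᴱ E′ = record
    { elements = cartesianProduct (elements E) (elements E′)
    ; unique   = Unique.cartesianProduct⁺ (unique E) (unique E′)
    ; complete = λ (x , y) → ∈-cartesianProduct⁺ (complete E x) (complete E′ y)
    }
    where open Enumeration

  Vecᴱ : ∀ n → Enumeration A → Enumeration (Vec A n)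
  Vecᴱ n E = record { elements = vectors n elements ; unique = uniq n ; complete = compl n }
    where
    open Enumeration E
    uniq : ∀ n → Unique (vectors n elements)
    uniq zero    = All.[] ∷ []
    uniq (suc n) = Unique.map⁺ (uncurry (cong₂ _,_) ∘ ∷-injective) (Unique.cartesianProduct⁺ unique (uniq n))
    compl : ∀ n → Complete (vectors n elements)
    compl zero    [] = here refl
    compl (suc n) (x ∷ v) = ∈-map⁺ (uncurry _∷_) (∈-cartesianProduct⁺ (complete x) (compl n v))

  mapᴱ : (f : A → B) → (∀ {x y} → f x ≡ f y → x ≡ y) → (∀ y → ∃[ x ] f x ≡ y) → Enumeration A → Enumeration B
  mapᴱ f f-injective f-surjective E = record
    { elements = map f elements
    ; unique   = Unique.map⁺ f-injective unique
    ; complete = λ y → let (x , fx≡y) = f-surjective y in subst (_∈ map f elements) fx≡y (∈-map⁺ f (complete x))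
    }
    where open Enumeration E

  Finᴱ : ∀ n → Enumeration (Fin n)
  Finᴱ n = record { elements = List.allFin n ; unique = Unique.allFin⁺ n ; complete = ∈-allFin }

  module _ (E : Enumeration A) {P : Pred A 0ℓ} (P? : U.Decidable P) where
    open Enumeration E

    ∀? : Dec (∀ x → P x)
    ∀? = map′ (λ Ps x → All.lookup Ps (complete x)) (λ Ps → All.tabulate λ {x} _ → Ps x) (All.all? P? elements)

    ∃? : Dec (∃ P)
    ∃? = map′ Any.satisfied (λ (x , Px) → Any.map (λ { refl → Px }) (complete x)) (Any.any? P? elements)

  Unique-lookup-injective : ∀ {xs : List A} → Unique xs → ∀ i j → List.lookup xs i ≡ List.lookup xs j → i ≡ j
  Unique-lookup-injective (x∉xs ∷ _)    Fin.zero    Fin.zero    _ = refl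
  Unique-lookup-injective (x∉xs ∷ _)    Fin.zero    (Fin.suc j) e = ⊥-elim (All.lookup x∉xs (∈-lookup j) e)
  Unique-lookup-injective (x∉xs ∷ _)    (Fin.suc i) Fin.zero    e = ⊥-elim (All.lookup x∉xs (∈-lookup i) (sym e))
  Unique-lookup-injective (_    ∷ uniq) (Fin.suc i) (Fin.suc j) e = cong Fin.suc (Unique-lookup-injective uniq i j e)

  length-≤-injection : ∀ {xs : List A} {ys : List B} → Unique xs → (f : A → B) →
                       (∀ {x} → x ∈ xs → f x ∈ ys) → (∀ {x y} → x ∈ xs → y ∈ xs → f x ≡ f y → x ≡ y) →
                       length xs ≤ length ys
  length-≤-injection {xs = xs} {ys} uniq f f∈ f-injective = Fin.injective⇒≤ {f = index} index-injective
    where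
    index : Fin (length xs) → Fin (length ys)
    index i = Any.index (f∈ (∈-lookup i))
    index-injective : ∀ {i j} → index i ≡ index j → i ≡ j
    index-injective {i} {j} e = Unique-lookup-injective uniq i j $ f-injective (∈-lookup i) (∈-lookup j) $
      trans (lookup-index (f∈ (∈-lookup i))) (trans (cong (List.lookup ys) e) (sym (lookup-index (f∈ (∈-lookup j)))))

  count-≤-injection : {P : Pred A 0ℓ} (P? : U.Decidable P) → ∀ {xs : List A} {ys : List B} → Unique xs → (f : A → B) →
                      (∀ {x} → x ∈ xs → P x → f x ∈ ys) →
                      (∀ {x y} → x ∈ xs → y ∈ xs → P x → P y → f x ≡ f y → x ≡ y) →
                      count P? xs ≤ length ys
  count-≤-injection P? uniq f f∈ f-injective = length-≤-injection (Unique.filter⁺ P? uniq) f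
    (λ x∈ → uncurry f∈ (∈-filter⁻ P? x∈))
    (λ x∈ y∈ → let (x∈xs , Px) = ∈-filter⁻ P? x∈ ; (y∈xs , Py) = ∈-filter⁻ P? y∈ in f-injective x∈xs y∈xs Px Py)

  count-image : (f : A → B) → (∀ {x y} → f x ≡ f y → x ≡ y) → (E : Enumeration A) (E′ : Enumeration B) →
                (P? : U.Decidable (λ y → ∃[ x ] f x ≡ y)) → count P? (Enumeration.elements E′) ≡ Enumeration.size E
  count-image f f-injective E E′ P? = ℕ.≤-antisym image≤ ≤image
    where
    open Enumeration
    image≤ : count P? (elements E′) ≤ size E
    image≤ = subst (count P? (elements E′) ≤_) (length-map f (elements E)) $
      length-≤-injection (Unique.filter⁺ P? (unique E′)) (λ y → y)
        (λ y∈ → let (x , fx≡y) = proj₂ (∈-filter⁻ P? {xs = elements E′} y∈) in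
                subst (_∈ map f (elements E)) fx≡y (∈-map⁺ f (complete E x)))
        (λ _ _ y≡y′ → y≡y′)
    ≤image : size E ≤ count P? (elements E′)
    ≤image = length-≤-injection (unique E) f (λ {x} _ → ∈-filter⁺ P? (complete E′ (f x)) (x , refl)) (λ _ _ → f-injective)

  ∈⇒0<length : ∀ {x : A} {xs} → x ∈ xs → 0 < length xs
  ∈⇒0<length (here _)  = ℕ.s≤s z≤n
  ∈⇒0<length (there _) = ℕ.s≤s z≤n

  averaging : (f : A → ℕ) (N : ℕ) → ∀ {xs} → 0 < length xs → ∑ xs f ≤ length xs * N → ∃[ x ] (x ∈ xs × f x ≤ N)
  averaging f N {xs} 0<len ∑≤ with Any.any? (λ x → f x ℕ.≤? N) xs
  ... | yes some = let (x , x∈ , fx≤N) = find some in x , x∈ , fx≤N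
  ... | no  none = ⊥-elim $ ℕ.<⇒≱ (ℕ.*-monoʳ-< (length xs) {{ℕ.>-nonZero 0<len}} (ℕ.n<1+n N)) $ begin
      length xs * suc N    ≡⟨ ∑-const xs (suc N) ⟨
      ∑[ _ ← xs ] suc N    ≤⟨ ∑-mono-≤ xs (λ x∈ → ℕ.≰⇒> λ fx≤N → none (Any.map (λ { refl → fx≤N }) x∈)) ⟩
      ∑ xs f               ≤⟨ ∑≤ ⟩
      length xs * N        ∎
    where open ℕ.≤-Reasoning

  square-bound : ∀ N Z L M Q → 0 < L → N * (L * L) ≤ Z * (Z * M) → Z * Q ≤ L → N * (Q * Q) ≤ M
  square-bound N Z L@(suc _) M Q _ N*L²≤Z²*M Z*Q≤L = ℕ.*-cancelʳ-≤ (N * (Q * Q)) M (L * L) $ begin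
    N * (Q * Q) * (L * L)        ≡⟨ lemma₁ N Q L ⟩
    N * (L * L) * (Q * Q)        ≤⟨ ℕ.*-monoˡ-≤ (Q * Q) N*L²≤Z²*M ⟩
    Z * (Z * M) * (Q * Q)        ≡⟨ lemma₂ Z M Q ⟩
    M * ((Z * Q) * (Z * Q))      ≤⟨ ℕ.*-monoʳ-≤ M (ℕ.*-mono-≤ Z*Q≤L Z*Q≤L) ⟩
    M * (L * L)                  ∎
    where
    open ℕ.≤-Reasoning
    lemma₁ : ∀ N Q L → N * (Q * Q) * (L * L) ≡ N * (L * L) * (Q * Q)
    lemma₁ = solve-∀
    lemma₂ : ∀ Z M Q → Z * (Z * M) * (Q * Q) ≡ M * ((Z * Q) * (Z * Q))
    lemma₂ = solve-∀

  *-^-distrib : ∀ a b n → (a * b) ^ n ≡ a ^ n * b ^ n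
  *-^-distrib a b zero    = refl
  *-^-distrib a b (suc n) = trans (cong (a * b *_) (*-^-distrib a b n)) (interchange a b (a ^ n) (b ^ n))
    where
    interchange : ∀ a b x y → a * b * (x * y) ≡ a * x * (b * y)
    interchange = solve-∀

  module Representatives {_≈_ : A → A → Set} (≈-isEquivalence : IsEquivalence _≈_)
                         (_≈?_ : ∀ x y → Dec (x ≈ y)) (_≟_ : DecidableEquality A) (R : List A) where
    open IsEquivalence ≈-isEquivalence renaming (refl to ≈-refl; sym to ≈-sym; trans to ≈-trans)

    firstEquivalent : A → List A → A
    firstEquivalent x []       = x
    firstEquivalent x (y ∷ ys) with y ≈? x
    ... | yes _ = y
    ... | no  _ = firstEquivalent x ys

    firstEquivalent-≈ : ∀ x ys → firstEquivalent x ys ≈ x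
    firstEquivalent-≈ x []       = ≈-refl
    firstEquivalent-≈ x (y ∷ ys) with y ≈? x
    ... | yes y≈x = y≈x
    ... | no  _   = firstEquivalent-≈ x ys

    firstEquivalent-∈ : ∀ {x ys} → x ∈ ys → firstEquivalent x ys ∈ ys
    firstEquivalent-∈ {x} {y ∷ ys} x∈ with y ≈? x | x∈
    ... | yes _   | _         = here refl
    ... | no  y≉x | here refl = ⊥-elim (y≉x ≈-refl)
    ... | no  _   | there x∈′ = there (firstEquivalent-∈ x∈′)

    firstEquivalent-cong : ∀ {x x′ ys} → x ∈ ys → x ≈ x′ → firstEquivalent x ys ≡ firstEquivalent x′ ys
    firstEquivalent-cong {x} {x′} {y ∷ ys} x∈ x≈x′ with y ≈? x | y ≈? x′ | x∈
    ... | yes _   | yes _    | _         = refl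
    ... | yes y≈x | no  y≉x′ | _         = ⊥-elim (y≉x′ (≈-trans y≈x x≈x′))
    ... | no  y≉x | yes y≈x′ | _         = ⊥-elim (y≉x (≈-trans y≈x′ (≈-sym x≈x′)))
    ... | no  y≉x | no  _    | here refl = ⊥-elim (y≉x ≈-refl)
    ... | no  _   | no  _    | there x∈′ = firstEquivalent-cong x∈′ x≈x′

    rep : A → A
    rep x = firstEquivalent x R

    representatives : List A
    representatives = filter (λ r → rep r ≟ r) R

    rep∈representatives : ∀ {x} → x ∈ R → rep x ∈ representatives
    rep∈representatives {x} x∈ =
      ∈-filter⁺ (λ r → rep r ≟ r) (firstEquivalent-∈ x∈) (firstEquivalent-cong (firstEquivalent-∈ x∈) (firstEquivalent-≈ x R))

    classIndex : ∀ {x} → x ∈ R → Fin (length representatives)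
    classIndex x∈ = Any.index (rep∈representatives x∈)

    classIndex-injective : ∀ {x y} (x∈ : x ∈ R) (y∈ : y ∈ R) → classIndex x∈ ≡ classIndex y∈ → x ≈ y
    classIndex-injective {x} {y} x∈ y∈ eq = ≈-trans (≈-sym (firstEquivalent-≈ x R))
      (subst (_≈ y) (sym (SetoidMembership.index-injective (setoid A) (rep∈representatives x∈) (rep∈representatives y∈) eq))
        (firstEquivalent-≈ y R))

    orbit-counting : Unique R → {G : Set} (gs : List G) → Unique gs → (act : A → G → A) →
                     (∀ {r g} → r ∈ R → g ∈ gs → act r g ∈ R) →
                     (∀ {r g} → r ∈ R → g ∈ gs → act r g ≈ r) →
                     (∀ {r g g′} → r ∈ R → g ∈ gs → g′ ∈ gs → act r g ≡ act r g′ → g ≡ g′) →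
                     length representatives * length gs ≤ length R
    orbit-counting R-unique gs gs-unique act act-∈ act-≈ act-injective =
      subst (_≤ length R) (length-cartesianProduct representatives gs) $
      length-≤-injection (Unique.cartesianProduct⁺ (Unique.filter⁺ (λ r → rep r ≟ r) R-unique) gs-unique) (uncurry act)
        (λ rg∈ → let (r∈ , g∈) = ∈-cartesianProduct⁻ representatives gs rg∈ in act-∈ (rep∈R r∈) g∈)
        injective
      where
      rep∈R : ∀ {r} → r ∈ representatives → r ∈ R
      rep∈R = proj₁ ∘ ∈-filter⁻ (λ r → rep r ≟ r) {xs = R}
      rep-fixed : ∀ {r} → r ∈ representatives → rep r ≡ r
      rep-fixed = proj₂ ∘ ∈-filter⁻ (λ r → rep r ≟ r) {xs = R}
      representative-unique : ∀ {r r′} → r ∈ representatives → r′ ∈ representatives → r ≈ r′ → r ≡ r′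
      representative-unique r∈ r′∈ r≈r′ =
        trans (sym (rep-fixed r∈)) (trans (firstEquivalent-cong (rep∈R r∈) r≈r′) (rep-fixed r′∈))
      injective : ∀ {rg rg′} → rg ∈ cartesianProduct representatives gs → rg′ ∈ cartesianProduct representatives gs →
                  uncurry act rg ≡ uncurry act rg′ → rg ≡ rg′
      injective {r , g} {r′ , g′} rg∈ rg′∈ eq =
        let (r∈ , g∈)   = ∈-cartesianProduct⁻ representatives gs rg∈
            (r′∈ , g′∈) = ∈-cartesianProduct⁻ representatives gs rg′∈
            r≡r′ = representative-unique r∈ r′∈
                     (≈-trans (≈-sym (act-≈ (rep∈R r∈) g∈)) (subst (_≈ r′) (sym eq) (act-≈ (rep∈R r′∈) g′∈)))
        in cong₂ _,_ r≡r′ (act-injective (rep∈R r∈) g∈ g′∈ (trans eq (cong (λ s → act s g′) (sym r≡r′))))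


open Counting
open Enumeration using (elements; unique; complete; size)

module Scalars {q : ℕ} (F : FiniteField q) where
  open FiniteField F public

  commutativeRing : CommutativeRing 0ℓ 0ℓ
  commutativeRing = record { isCommutativeRing = isCommutativeRing }

  open CommutativeRing commutativeRing public
    using (+-assoc; +-comm; +-identityˡ; +-identityʳ; -‿inverseˡ; -‿inverseʳ;
           *-assoc; *-comm; *-identityˡ; *-identityʳ; zeroˡ; zeroʳ)
  open Algebra.Properties.Ring (CommutativeRing.ring commutativeRing) public using (-‿distribˡ-*)
  open Algebra.Properties.AbelianGroup (CommutativeRing.+-abelianGroup commutativeRing) public
    using () renaming (∙-cancelˡ to +-cancelˡ; ∙-cancelʳ to +-cancelʳ; x∙y⁻¹≈ε⇒x≈y to x-y≡0⇒x≡y)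

  infix 4 _≟_
  _≟_ : DecidableEquality Carrier
  x ≟ y = map′ (λ e → trans (sym (strictlyInverseˡ x)) (trans (cong to e) (strictlyInverseˡ y))) (cong from)
               (from x Fin.≟ from y)
    where open Inverse card

  open Algebra.Solver.Ring.NaturalCoefficients.Default (CommutativeRing.commutativeSemiring commutativeRing) public
    using (solve; _:=_; _:+_; _:*_; con)

  scalarsᴱ : Enumeration Carrier
  scalarsᴱ = mapᴱ to to-injective (λ y → from y , strictlyInverseˡ y) (Finᴱ q)
    where
    open Inverse card
    to-injective : ∀ {i j} → to i ≡ to j → i ≡ j
    to-injective {i} {j} e = trans (sym (strictlyInverseʳ i)) (trans (cong from e) (strictlyInverseʳ j))

  size-scalarsᴱ : size scalarsᴱ ≡ q
  size-scalarsᴱ = trans (length-map _ (List.allFin q)) (length-tabulate {n = q} (λ i → i))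

  1≢0 : 1# ≢ 0#
  1≢0 = 0≢1 ∘ sym

  -x≡0⇒x≡0 : ∀ {x} → - x ≡ 0# → x ≡ 0#
  -x≡0⇒x≡0 {x} -x≡0 = trans (sym (+-identityʳ x)) (trans (cong (x +_) (sym -x≡0)) (-‿inverseʳ x))

  inverseˡ : ∀ x → x ≢ 0# → ∃[ y ] y * x ≡ 1#
  inverseˡ x x≢0 = let (y , xy≡1) = inverse x x≢0 in y , trans (*-comm y x) xy≡1

  *-cancelˡ : ∀ {a x y} → a ≢ 0# → a * x ≡ a * y → x ≡ y
  *-cancelˡ {a} {x} {y} a≢0 ax≡ay = begin
    x           ≡⟨ *-identityˡ x ⟨
    1# * x      ≡⟨ cong (_* x) ba≡1 ⟨
    b * a * x   ≡⟨ *-assoc b a x ⟩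
    b * (a * x) ≡⟨ cong (b *_) ax≡ay ⟩
    b * (a * y) ≡⟨ *-assoc b a y ⟨
    b * a * y   ≡⟨ cong (_* y) ba≡1 ⟩
    1# * y      ≡⟨ *-identityˡ y ⟩
    y           ∎
    where
    open ≡-Reasoning
    b = proj₁ (inverseˡ a a≢0)
    ba≡1 = proj₂ (inverseˡ a a≢0)

module Vectors {q : ℕ} (F : FiniteField q) where
  open Scalars F public

  Vector : ℕ → Set
  Vector = Vecᶠ F

  infixl 6 _+v_
  infixr 7 _·v_

  _+v_ : ∀ {k} → Vector k → Vector k → Vector k
  _+v_ = _+ᵛ_ F

  _·v_ : ∀ {k} → Carrier → Vector k → Vector k
  _·v_ = _·ᵛ_ F

  0v : ∀ {k} → Vector k
  0v = 0ᵛ F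

  lincomb : ∀ {k} → Carrier → Vector k → Carrier → Vector k → Vector k
  lincomb a u b w = a ·v u +v b ·v w

  infix 4 _≟v_
  _≟v_ : ∀ {k} → DecidableEquality (Vector k)
  _≟v_ = ≡-dec _≟_

  vectorsᴱ : ∀ k → Enumeration (Vector k)
  vectorsᴱ k = Vecᴱ k scalarsᴱ

  size-vectorsᴱ : ∀ k → size (vectorsᴱ k) ≡ q ^ k
  size-vectorsᴱ k = trans (length-vectors k _) (cong (_^ k) size-scalarsᴱ)

  lookup-0v : ∀ {k} i → lookup (0v {k}) i ≡ 0#
  lookup-0v i = lookup-replicate i 0#

  lookup-·v : ∀ {k} a (u : Vector k) i → lookup (a ·v u) i ≡ a * lookup u i
  lookup-·v a u i = lookup-map i (a *_) u

  lookup-lincomb : ∀ {k} a (u : Vector k) b w i → lookup (lincomb a u b w) i ≡ a * lookup u i + b * lookup w i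
  lookup-lincomb a u b w i = trans (lookup-zipWith _+_ i (a ·v u) (b ·v w)) (cong₂ _+_ (lookup-·v a u i) (lookup-·v b w i))

  lincomb-lincomb : ∀ {k} a α β b γ δ (u w : Vector k) →
                    lincomb a (lincomb α u β w) b (lincomb γ u δ w) ≡ lincomb (a * α + b * γ) u (a * β + b * δ) w
  lincomb-lincomb a α β b γ δ u w = ≡-pointwise λ i → begin
    lookup (lincomb a (lincomb α u β w) b (lincomb γ u δ w)) i
      ≡⟨ lookup-lincomb a (lincomb α u β w) b (lincomb γ u δ w) i ⟩
    a * lookup (lincomb α u β w) i + b * lookup (lincomb γ u δ w) i
      ≡⟨ cong₂ (λ x y → a * x + b * y) (lookup-lincomb α u β w i) (lookup-lincomb γ u δ w i) ⟩
    a * (α * lookup u i + β * lookup w i) + b * (γ * lookup u i + δ * lookup w i)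
      ≡⟨ solve 8 (λ a α β b γ δ x y → a :* (α :* x :+ β :* y) :+ b :* (γ :* x :+ δ :* y)
                                    := (a :* α :+ b :* γ) :* x :+ (a :* β :+ b :* δ) :* y)
               refl a α β b γ δ (lookup u i) (lookup w i) ⟩
    (a * α + b * γ) * lookup u i + (a * β + b * δ) * lookup w i
      ≡⟨ lookup-lincomb _ u _ w i ⟨
    lookup (lincomb (a * α + b * γ) u (a * β + b * δ) w) i ∎
    where open ≡-Reasoning

  lincomb-00 : ∀ {k} (u w : Vector k) → lincomb 0# u 0# w ≡ 0v
  lincomb-00 u w = ≡-pointwise λ i → trans (lookup-lincomb 0# u 0# w i)
    (trans (solve 2 (λ x y → con 0 :* x :+ con 0 :* y := con 0) refl (lookup u i) (lookup w i)) (sym (lookup-0v i)))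

  lincomb-10 : ∀ {k} (u w : Vector k) → lincomb 1# u 0# w ≡ u
  lincomb-10 u w = ≡-pointwise λ i → trans (lookup-lincomb 1# u 0# w i)
    (solve 2 (λ x y → con 1 :* x :+ con 0 :* y := x) refl (lookup u i) (lookup w i))

  lincomb-01 : ∀ {k} (u w : Vector k) → lincomb 0# u 1# w ≡ w
  lincomb-01 u w = ≡-pointwise λ i → trans (lookup-lincomb 0# u 1# w i)
    (solve 2 (λ x y → con 0 :* x :+ con 1 :* y := y) refl (lookup u i) (lookup w i))

  ·v-lincomb : ∀ {k} e a b (u w : Vector k) → e ·v lincomb a u b w ≡ lincomb (e * a) u (e * b) w
  ·v-lincomb e a b u w = ≡-pointwise λ i → begin
    lookup (e ·v lincomb a u b w) i          ≡⟨ lookup-·v e (lincomb a u b w) i ⟩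
    e * lookup (lincomb a u b w) i           ≡⟨ cong (e *_) (lookup-lincomb a u b w i) ⟩
    e * (a * lookup u i + b * lookup w i)    ≡⟨ solve 5 (λ e a b x y → e :* (a :* x :+ b :* y) := e :* a :* x :+ e :* b :* y)
                                                      refl e a b (lookup u i) (lookup w i) ⟩
    e * a * lookup u i + e * b * lookup w i  ≡⟨ lookup-lincomb (e * a) u (e * b) w i ⟨
    lookup (lincomb (e * a) u (e * b) w) i   ∎
    where open ≡-Reasoning

  nonzero-entry : ∀ {k} {u : Vector k} → u ≢ 0v → ∃[ r ] lookup u r ≢ 0#
  nonzero-entry {u = u} u≢0 with Fin.any? (λ i → ¬? (lookup u i ≟ 0#))
  ... | yes found = found
  ... | no  none  = ⊥-elim (u≢0 (≡-pointwise λ i → trans (decidable-stable (lookup u i ≟ 0#) (none ∘ (i ,_))) (sym (lookup-0v i))))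

  dot : ∀ {n} → Vector n → Vector n → Carrier
  dot []      []      = 0#
  dot (x ∷ v) (y ∷ w) = x * y + dot v w

  dot-update : ∀ {n} (v X : Vector n) r → dot v X ≡ dot v (X [ r ]≔ 0#) + lookup v r * lookup X r
  dot-update (a ∷ v) (x ∷ X) Fin.zero    = solve 3 (λ a x D → a :* x :+ D := (a :* con 0 :+ D) :+ a :* x) refl a x (dot v X)
  dot-update (a ∷ v) (x ∷ X) (Fin.suc r) = trans (cong (a * x +_) (dot-update v X r)) (sym (+-assoc (a * x) _ _))

  module _ {n} {r s : Fin n} (r≢s : r ≢ s) where

    private
      erase : Vector n → Vector n
      erase X = (X [ r ]≔ 0#) [ s ]≔ 0#

      dot-erase : ∀ v X → dot v X ≡ dot v (erase X) + (lookup v r * lookup X r + lookup v s * lookup X s)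
      dot-erase v X = begin
        dot v X                                                     ≡⟨ dot-update v X r ⟩
        dot v (X [ r ]≔ 0#) + vr * lookup X r                       ≡⟨ cong (_+ vr * lookup X r) (dot-update v (X [ r ]≔ 0#) s) ⟩
        dot v (erase X) + vs * lookup (X [ r ]≔ 0#) s + vr * lookup X r
          ≡⟨ cong (λ x → dot v (erase X) + vs * x + vr * lookup X r) (lookup∘update′ (r≢s ∘ sym) X 0#) ⟩
        dot v (erase X) + vs * lookup X s + vr * lookup X r         ≡⟨ solve 3 (λ D A B → D :+ A :+ B := D :+ (B :+ A)) refl (dot v (erase X)) _ _ ⟩
        dot v (erase X) + (vr * lookup X r + vs * lookup X s)       ∎
        where
        open ≡-Reasoning
        vr = lookup v r ; vs = lookup v s

    dot-two-coordinates : ∀ {v X X′ : Vector n} → (∀ i → i ≢ r → i ≢ s → lookup X i ≡ lookup X′ i) → dot v X ≡ dot v X′ →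
                          lookup v r * lookup X r + lookup v s * lookup X s ≡ lookup v r * lookup X′ r + lookup v s * lookup X′ s
    dot-two-coordinates {v} {X} {X′} agree vX≡vX′ =
      +-cancelˡ (dot v (erase X)) _ _ $
        trans (sym (dot-erase v X)) (trans vX≡vX′ (trans (dot-erase v X′) (cong (λ Y → dot v Y + _) (sym erase-X≡erase-X′))))
      where
      erase-X≡erase-X′ : erase X ≡ erase X′
      erase-X≡erase-X′ = ≡-pointwise λ i → erased i (i Fin.≟ r) (i Fin.≟ s)
        where
        erased : ∀ i → Dec (i ≡ r) → Dec (i ≡ s) → lookup (erase X) i ≡ lookup (erase X′) i
        erased i _          (yes refl) = trans (lookup∘update i (X [ r ]≔ 0#) 0#) (sym (lookup∘update i (X′ [ r ]≔ 0#) 0#))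
        erased i (yes refl) (no i≢s)   = trans (lookup∘update′ i≢s (X [ r ]≔ 0#) 0#) (trans (lookup∘update i X 0#)
                                           (sym (trans (lookup∘update′ i≢s (X′ [ r ]≔ 0#) 0#) (lookup∘update i X′ 0#))))
        erased i (no i≢r)   (no i≢s)   = trans (lookup∘update′ i≢s (X [ r ]≔ 0#) 0#) (trans (lookup∘update′ i≢r X 0#) (trans (agree i i≢r i≢s)
                                           (sym (trans (lookup∘update′ i≢s (X′ [ r ]≔ 0#) 0#) (lookup∘update′ i≢r X′ 0#)))))

    dot-determined : ∀ {u w X X′ : Vector n} → lookup u r ≢ 0# → lookup w r ≡ 0# → lookup w s ≢ 0# →
                     (∀ i → i ≢ r → i ≢ s → lookup X i ≡ lookup X′ i) → dot u X ≡ dot u X′ → dot w X ≡ dot w X′ → X ≡ X′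
    dot-determined {u} {w} {X} {X′} ur≢0 wr≡0 ws≢0 agree uX≡uX′ wX≡wX′ = ≡-pointwise λ i → same i (i Fin.≟ r) (i Fin.≟ s)
      where
      drop-r : ∀ x y → lookup w r * x + y ≡ y
      drop-r x y = trans (cong (λ z → z * x + y) wr≡0) (trans (cong (_+ y) (zeroˡ x)) (+-identityˡ y))
      Xs≡X′s : lookup X s ≡ lookup X′ s
      Xs≡X′s = *-cancelˡ ws≢0 (trans (sym (drop-r (lookup X r) _)) (trans (dot-two-coordinates {w} {X} {X′} agree wX≡wX′) (drop-r (lookup X′ r) _)))
      Xr≡X′r : lookup X r ≡ lookup X′ r
      Xr≡X′r = *-cancelˡ ur≢0 (+-cancelʳ (lookup u s * lookup X s) _ _
                 (trans (dot-two-coordinates {u} {X} {X′} agree uX≡uX′) (cong (λ x → lookup u r * lookup X′ r + lookup u s * x) (sym Xs≡X′s))))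
      same : ∀ i → Dec (i ≡ r) → Dec (i ≡ s) → lookup X i ≡ lookup X′ i
      same i (yes refl) _          = Xr≡X′r
      same i (no _)     (yes refl) = Xs≡X′s
      same i (no i≢r)   (no i≢s)   = agree i i≢r i≢s

module Independence {q : ℕ} (F : FiniteField q) where
  open Vectors F public

  lincomb≡0v : ∀ {k a b} {u w : Vector k} → lincomb a u b w ≡ 0v → ∀ i → a * lookup u i + b * lookup w i ≡ 0#
  lincomb≡0v {a = a} {b} {u} {w} eq i = trans (sym (lookup-lincomb a u b w i)) (trans (cong (λ v → lookup v i) eq) (lookup-0v i))

  Independent : ∀ {k} → Vector k → Vector k → Set
  Independent u w = ∀ a b → lincomb a u b w ≡ 0v → a ≡ 0# × b ≡ 0#

  independent? : ∀ {k} (u w : Vector k) → Dec (Independent u w)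
  independent? u w = ∀? scalarsᴱ λ a → ∀? scalarsᴱ λ b → lincomb a u b w ≟v 0v →-dec (a ≟ 0# ×-dec b ≟ 0#)

  module _ {k} {u w : Vector k} where

    independent⇒≢0v : Independent u w → u ≢ 0v
    independent⇒≢0v ind u≡0 = 1≢0 (proj₁ (ind 1# 0# (trans (lincomb-10 u w) u≡0)))

    independent⇒∉line : Independent u w → ∀ a → a ·v u ≢ w
    independent⇒∉line ind a refl = 1≢0 $ proj₂ $ ind (- a) 1# $ ≡-pointwise λ i → begin
      lookup (lincomb (- a) u 1# (a ·v u)) i       ≡⟨ lookup-lincomb (- a) u 1# (a ·v u) i ⟩
      - a * lookup u i + 1# * lookup (a ·v u) i    ≡⟨ cong (λ y → - a * lookup u i + 1# * y) (lookup-·v a u i) ⟩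
      - a * lookup u i + 1# * (a * lookup u i)     ≡⟨ solve 3 (λ na a x → na :* x :+ con 1 :* (a :* x) := (na :+ a) :* x) refl (- a) a (lookup u i) ⟩
      (- a + a) * lookup u i                       ≡⟨ cong (_* lookup u i) (-‿inverseˡ a) ⟩
      0# * lookup u i                              ≡⟨ zeroˡ _ ⟩
      0#                                           ≡⟨ lookup-0v i ⟨
      lookup 0v i                                  ∎
      where open ≡-Reasoning

    ≢0v∧∉line⇒independent : u ≢ 0v → (∀ a → a ·v u ≢ w) → Independent u w
    ≢0v∧∉line⇒independent u≢0 ∉line a b eq with b ≟ 0#
    ... | no  b≢0  = ⊥-elim (∉line (- (c * a)) (≡-pointwise w-on-line))
      where
      open ≡-Reasoning
      c = proj₁ (inverseˡ b b≢0)
      cb≡1 = proj₂ (inverseˡ b b≢0)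
      w-on-line : ∀ i → lookup (- (c * a) ·v u) i ≡ lookup w i
      w-on-line i = let x = lookup u i ; y = lookup w i in begin
        lookup (- (c * a) ·v u) i              ≡⟨ lookup-·v (- (c * a)) u i ⟩
        - (c * a) * x                          ≡⟨ solve 3 (λ n c x → n :* x := n :* x :+ c :* con 0) refl (- (c * a)) c x ⟩
        - (c * a) * x + c * 0#                 ≡⟨ cong (λ z → - (c * a) * x + c * z) (lincomb≡0v eq i) ⟨
        - (c * a) * x + c * (a * x + b * y)    ≡⟨ solve 6 (λ n c a b x y → n :* x :+ c :* (a :* x :+ b :* y) := (c :* a :+ n) :* x :+ (c :* b) :* y)
                                                        refl (- (c * a)) c a b x y ⟩
        (c * a + - (c * a)) * x + (c * b) * y  ≡⟨ cong₂ (λ s t → s * x + t * y) (-‿inverseʳ (c * a)) cb≡1 ⟩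
        0# * x + 1# * y                        ≡⟨ solve 2 (λ x y → con 0 :* x :+ con 1 :* y := y) refl x y ⟩
        y                                      ∎
    ... | yes refl = a≡0 , refl
      where
      r = proj₁ (nonzero-entry u≢0)
      ur≢0 = proj₂ (nonzero-entry u≢0)
      a≡0 : a ≡ 0#
      a≡0 = *-cancelˡ ur≢0 $ begin
        lookup u r * a                        ≡⟨ solve 3 (λ a x y → x :* a := a :* x :+ con 0 :* y) refl a (lookup u r) (lookup w r) ⟩
        a * lookup u r + 0# * lookup w r      ≡⟨ lincomb≡0v eq r ⟩
        0#                                    ≡⟨ zeroʳ _ ⟨
        lookup u r * 0#                       ∎
        where open ≡-Reasoning

  ·v-injectiveˡ : ∀ {k} {u : Vector k} {a b} → u ≢ 0v → a ·v u ≡ b ·v u → a ≡ b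
  ·v-injectiveˡ {u = u} {a} {b} u≢0 eq = *-cancelˡ ur≢0 $ begin
    lookup u r * a     ≡⟨ *-comm _ a ⟩
    a * lookup u r     ≡⟨ lookup-·v a u r ⟨
    lookup (a ·v u) r  ≡⟨ cong (λ v → lookup v r) eq ⟩
    lookup (b ·v u) r  ≡⟨ lookup-·v b u r ⟩
    b * lookup u r     ≡⟨ *-comm b _ ⟩
    lookup u r * b     ∎
    where
    open ≡-Reasoning
    r = proj₁ (nonzero-entry u≢0)
    ur≢0 = proj₂ (nonzero-entry u≢0)

  OnLine : ∀ {k} → Vector k → Vector k → Set
  OnLine u w = ∃[ a ] a ·v u ≡ w

  onLine? : ∀ {k} (u w : Vector k) → Dec (OnLine u w)
  onLine? u w = ∃? scalarsᴱ λ a → a ·v u ≟v w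

  count-onLine : ∀ {k} {u : Vector k} → u ≢ 0v → count (onLine? u) (elements (vectorsᴱ k)) ≡ q
  count-onLine {k} {u} u≢0 = trans (count-image (_·v u) (·v-injectiveˡ u≢0) scalarsᴱ (vectorsᴱ k) (onLine? u)) size-scalarsᴱ

  count-independent : ∀ {k} (u : Vector k) → u ≢ 0v → count (independent? u) (elements (vectorsᴱ k)) ≡ q ^ k ∸ q
  count-independent {k} u u≢0 = begin
    count (independent? u) vs          ≡⟨ count-≐ (independent? u) (¬? ∘ onLine? u) (independent⇔∉line) vs ⟩
    count (¬? ∘ onLine? u) vs          ≡⟨ count-¬ (onLine? u) vs ⟩
    length vs ∸ count (onLine? u) vs   ≡⟨ cong₂ _∸_ (size-vectorsᴱ k) (count-onLine u≢0) ⟩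
    q ^ k ∸ q                          ∎
    where
    open ≡-Reasoning
    vs = elements (vectorsᴱ k)
    independent⇔∉line : Independent u ≐ (¬_ ∘ OnLine u)
    independent⇔∉line = (λ ind (a , a·u≡w) → independent⇒∉line ind a a·u≡w)
                      , (λ ∉line → ≢0v∧∉line⇒independent u≢0 (λ a a·u≡w → ∉line (a , a·u≡w)))

  Pair : ℕ → Set
  Pair k = Vector k × Vector k

  pairsᴱ : ∀ k → Enumeration (Pair k)
  pairsᴱ k = vectorsᴱ k ×ᴱ vectorsᴱ k

  independentPair? : ∀ {k} → U.Decidable (uncurry (Independent {k}))
  independentPair? (u , w) = independent? u w

  count-independentPairs : ∀ k → count independentPair? (elements (pairsᴱ k)) ≡ (q ^ k ∸ 1) ℕ.* (q ^ k ∸ q)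
  count-independentPairs k = begin
    count independentPair? (cartesianProduct vs vs)               ≡⟨ count-cartesianProduct independentPair? vs vs ⟩
    ∑[ u ← vs ] count (independent? u) vs                          ≡⟨ ∑-indicator (¬? ∘ (_≟v 0v)) vs (count-independent _)
        (λ ¬u≢0 → count-none (independent? _) {vs} (All.tabulate λ _ ind → ¬u≢0 (independent⇒≢0v ind))) ⟩
    count (¬? ∘ (_≟v 0v)) vs ℕ.* (q ^ k ∸ q)                       ≡⟨ cong (ℕ._* (q ^ k ∸ q)) (count-¬ (_≟v 0v) vs) ⟩
    (length vs ∸ count (_≟v 0v) vs) ℕ.* (q ^ k ∸ q)                ≡⟨ cong₂ (λ m n → (m ∸ n) ℕ.* (q ^ k ∸ q)) (size-vectorsᴱ k)
                                                                             (count-≟ _≟v_ (unique (vectorsᴱ k)) (complete (vectorsᴱ k) 0v)) ⟩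
    (q ^ k ∸ 1) ℕ.* (q ^ k ∸ q)                                    ∎
    where
    open ≡-Reasoning
    vs = elements (vectorsᴱ k)

  lincomb-injective : ∀ {k} {u w : Vector k} {a b a′ b′} → Independent u w →
                      lincomb a u b w ≡ lincomb a′ u b′ w → a ≡ a′ × b ≡ b′
  lincomb-injective {u = u} {w} {a} {b} {a′} {b′} ind eq =
    let (a-a′≡0 , b-b′≡0) = ind (a + - a′) (b + - b′) (≡-pointwise difference≡0)
    in x-y≡0⇒x≡y a a′ a-a′≡0 , x-y≡0⇒x≡y b b′ b-b′≡0
    where
    difference≡0 : ∀ i → lookup (lincomb (a + - a′) u (b + - b′) w) i ≡ lookup 0v i
    difference≡0 i = let x = lookup u i ; y = lookup w i in begin
      lookup (lincomb (a + - a′) u (b + - b′) w) i        ≡⟨ lookup-lincomb (a + - a′) u (b + - b′) w i ⟩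
      (a + - a′) * x + (b + - b′) * y                     ≡⟨ solve 6 (λ a b na′ nb′ x y → (a :+ na′) :* x :+ (b :+ nb′) :* y
                                                                                    := (a :* x :+ b :* y) :+ (na′ :* x :+ nb′ :* y))
                                                                   refl a b (- a′) (- b′) x y ⟩
      (a * x + b * y) + (- a′ * x + - b′ * y)             ≡⟨ cong (_+ (- a′ * x + - b′ * y))
                                                                  (trans (sym (lookup-lincomb a u b w i)) (trans (cong (λ v → lookup v i) eq) (lookup-lincomb a′ u b′ w i))) ⟩
      (a′ * x + b′ * y) + (- a′ * x + - b′ * y)           ≡⟨ solve 6 (λ a′ b′ na′ nb′ x y → (a′ :* x :+ b′ :* y) :+ (na′ :* x :+ nb′ :* y)
                                                                                    := (a′ :+ na′) :* x :+ (b′ :+ nb′) :* y)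
                                                                   refl a′ b′ (- a′) (- b′) x y ⟩
      (a′ + - a′) * x + (b′ + - b′) * y                   ≡⟨ cong₂ (λ s t → s * x + t * y) (-‿inverseʳ a′) (-‿inverseʳ b′) ⟩
      0# * x + 0# * y                                     ≡⟨ solve 2 (λ x y → con 0 :* x :+ con 0 :* y := con 0) refl x y ⟩
      0#                                                  ≡⟨ lookup-0v i ⟨
      lookup 0v i                                         ∎
      where open ≡-Reasoning

module Spans {q : ℕ} (F : FiniteField q) where
  open Independence F public

  infix 4 _∈span_ _∈span?_ _≈span_ _≈span?_

  _∈span_ : ∀ {k} → Vector k → Pair k → Set
  x ∈span (u , w) = ∃[ a ] ∃[ b ] x ≡ lincomb a u b w

  _∈span?_ : ∀ {k} (x : Vector k) (P : Pair k) → Dec (x ∈span P)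
  x ∈span? (u , w) = ∃? scalarsᴱ λ a → ∃? scalarsᴱ λ b → x ≟v lincomb a u b w

  _≈span_ : ∀ {k} → Pair k → Pair k → Set
  P ≈span P′ = ∀ x → (x ∈span P → x ∈span P′) × (x ∈span P′ → x ∈span P)

  _≈span?_ : ∀ {k} (P P′ : Pair k) → Dec (P ≈span P′)
  P ≈span? P′ = ∀? (vectorsᴱ _) λ x → (x ∈span? P →-dec x ∈span? P′) ×-dec (x ∈span? P′ →-dec x ∈span? P)

  ∈span-trans : ∀ {k} {u w u′ w′ x : Vector k} → u′ ∈span (u , w) → w′ ∈span (u , w) → x ∈span (u′ , w′) → x ∈span (u , w)
  ∈span-trans {u = u} {w} (α , β , refl) (γ , δ , refl) (a , b , refl) = _ , _ , lincomb-lincomb a α β b γ δ u w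

  -- Cramer’s rule: d·u′ − b·w′ = Δ·u and −c·u′ + a·w′ = Δ·w, while Δ = 0 would force u′ = 0.
  module _ {k} {u w : Vector k} {a b c d : Carrier} where

    private
      Δ : Carrier
      Δ = a * d + - b * c

      u′ w′ : Vector k
      u′ = lincomb a u b w
      w′ = lincomb c u d w

      eliminate-w : lincomb d u′ (- b) w′ ≡ lincomb Δ u 0# w
      eliminate-w = trans (lincomb-lincomb d a b (- b) c d u w) (cong₂ (λ s t → lincomb s u t w) (cong (_+ - b * c) (*-comm d a)) db-bd≡0)
        where
        db-bd≡0 : d * b + - b * d ≡ 0#
        db-bd≡0 = trans (solve 3 (λ d b nb → d :* b :+ nb :* d := d :* (b :+ nb)) refl d b (- b))
                        (trans (cong (d *_) (-‿inverseʳ b)) (zeroʳ d))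

      eliminate-u : lincomb (- c) u′ a w′ ≡ lincomb 0# u Δ w
      eliminate-u = trans (lincomb-lincomb (- c) a b a c d u w) (cong₂ (λ s t → lincomb s u t w) ca-ac≡0 cb-ad≡Δ)
        where
        ca-ac≡0 : - c * a + a * c ≡ 0#
        ca-ac≡0 = trans (solve 3 (λ nc a c → nc :* a :+ a :* c := a :* (c :+ nc)) refl (- c) a c)
                        (trans (cong (a *_) (-‿inverseʳ c)) (zeroʳ a))
        cb-ad≡Δ : - c * b + a * d ≡ Δ
        cb-ad≡Δ = trans (+-comm _ _) (cong (a * d +_)
                    (trans (sym (-‿distribˡ-* c b)) (trans (cong -_ (*-comm c b)) (-‿distribˡ-* b c))))

      rescale : ∀ {e α β γ δ} {v : Vector k} → e * Δ ≡ 1# → lincomb α u′ β w′ ≡ lincomb γ u δ w →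
                v ≡ lincomb (e * γ) u (e * δ) w → v ∈span (u′ , w′)
      rescale {e} {α} {β} {γ} {δ} {v} eΔ≡1 eq v≡ = e * α , e * β , (begin
        v                                   ≡⟨ v≡ ⟩
        lincomb (e * γ) u (e * δ) w         ≡⟨ ·v-lincomb e γ δ u w ⟨
        e ·v lincomb γ u δ w                ≡⟨ cong (e ·v_) eq ⟨
        e ·v lincomb α u′ β w′              ≡⟨ ·v-lincomb e α β u′ w′ ⟩
        lincomb (e * α) u′ (e * β) w′       ∎)
        where open ≡-Reasoning

    basis-change : Independent u′ w′ → u ∈span (u′ , w′) × w ∈span (u′ , w′)
    basis-change ind with Δ ≟ 0#
    ... | no Δ≢0 =
      let (e , eΔ≡1) = inverseˡ Δ Δ≢0 in
        rescale eΔ≡1 eliminate-w (sym (trans (cong₂ (λ s t → lincomb s u t w) eΔ≡1 (zeroʳ e)) (lincomb-10 u w)))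
      , rescale eΔ≡1 eliminate-u (sym (trans (cong₂ (λ s t → lincomb s u t w) (zeroʳ e) eΔ≡1) (lincomb-01 u w)))
    ... | yes Δ≡0 = ⊥-elim (independent⇒≢0v ind u′≡0)
      where
      a≡0 : a ≡ 0#
      a≡0 = proj₂ (ind (- c) a (trans eliminate-u (trans (cong (λ t → lincomb 0# u t w) Δ≡0) (lincomb-00 u w))))
      b≡0 : b ≡ 0#
      b≡0 = -x≡0⇒x≡0 (proj₂ (ind d (- b) (trans eliminate-w (trans (cong (λ s → lincomb s u 0# w) Δ≡0) (lincomb-00 u w)))))
      u′≡0 : u′ ≡ 0v
      u′≡0 = trans (cong₂ (λ s t → lincomb s u t w) a≡0 b≡0) (lincomb-00 u w)

  -- g : Pair 2 is the 2×2 matrix with rows g, and act P g is the pair g·P; g is invertible iff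
  -- its rows are independent, and then g·P spans the same plane as P.
  act : ∀ {k} → Pair k → Pair 2 → Pair k
  act (u , w) ((a ∷ b ∷ []) , (c ∷ d ∷ [])) = lincomb a u b w , lincomb c u d w

  module _ {k} {u w : Vector k} (ind : Independent u w) where

    act-independent : ∀ g → uncurry Independent g → uncurry Independent (act (u , w) g)
    act-independent ((a ∷ b ∷ []) , (c ∷ d ∷ [])) ind-g x y eq =
      let (xa+yc≡0 , xb+yd≡0) = ind _ _ (trans (sym (lincomb-lincomb x a b y c d u w)) eq)
      in ind-g x y (cong₂ (λ s t → s ∷ t ∷ []) xa+yc≡0 xb+yd≡0)

    act-≈span : ∀ g → uncurry Independent g → act (u , w) g ≈span (u , w)
    act-≈span g@((a ∷ b ∷ []) , (c ∷ d ∷ [])) ind-g x =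
        ∈span-trans (a , b , refl) (c , d , refl)
      , ∈span-trans (proj₁ (basis-change (act-independent g ind-g))) (proj₂ (basis-change (act-independent g ind-g)))

    act-injective : ∀ g g′ → act (u , w) g ≡ act (u , w) g′ → g ≡ g′
    act-injective ((a ∷ b ∷ []) , (c ∷ d ∷ [])) ((a′ ∷ b′ ∷ []) , (c′ ∷ d′ ∷ [])) eq =
      let (a≡a′ , b≡b′) = lincomb-injective ind (cong proj₁ eq)
          (c≡c′ , d≡d′) = lincomb-injective ind (cong proj₂ eq)
      in cong₂ _,_ (cong₂ (λ s t → s ∷ t ∷ []) a≡a′ b≡b′) (cong₂ (λ s t → s ∷ t ∷ []) c≡c′ d≡d′)

module Tensors {q : ℕ} (F : FiniteField q) (k : ℕ) where
  open Spans F public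

  -- A Tensor d is a d-index array over Fin k; eval c (v₁ ∷ … ∷ v_d) is the d-linear form
  -- Σ c[i₁…i_d] v₁[i₁] ⋯ v_d[i_d], computed by contracting one index at a time.
  data Tensor : ℕ → Set where
    scalar : Carrier → Tensor zero
    slices : ∀ {d} → Vec (Tensor d) k → Tensor (suc d)

  slices-injective : ∀ {d} {cs cs′ : Vec (Tensor d) k} → slices cs ≡ slices cs′ → cs ≡ cs′
  slices-injective refl = refl

  tensorsᴱ : ∀ d → Enumeration (Tensor d)
  tensorsᴱ zero    = mapᴱ scalar (λ { refl → refl }) (λ { (scalar x) → x , refl }) scalarsᴱ
  tensorsᴱ (suc d) = mapᴱ slices slices-injective (λ { (slices cs) → cs , refl }) (Vecᴱ k (tensorsᴱ d))

  entry : ∀ {d} → Tensor d → Vec (Fin k) d → Carrier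
  entry (scalar x)  []      = x
  entry (slices cs) (i ∷ ι) = entry (lookup cs i) ι

  ≡-entrywise : ∀ {d} {c c′ : Tensor d} → (∀ ι → entry c ι ≡ entry c′ ι) → c ≡ c′
  ≡-entrywise {c = scalar x}  {scalar y}    c≗c′ = cong scalar (c≗c′ [])
  ≡-entrywise {c = slices cs} {slices cs′} c≗c′ = cong slices (≡-pointwise λ i → ≡-entrywise λ ι → c≗c′ (i ∷ ι))

  0ᵗ : ∀ {d} → Tensor d
  0ᵗ {zero}  = scalar 0#
  0ᵗ {suc d} = slices (replicate k 0ᵗ)

  axpy : ∀ {d} → Carrier → Tensor d → Tensor d → Tensor d
  axpy a (scalar x)  (scalar y)   = scalar (a * x + y)
  axpy a (slices cs) (slices cs′) = slices (zipWith (axpy a) cs cs′)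

  entry-0ᵗ : ∀ {d} (ι : Vec (Fin k) d) → entry 0ᵗ ι ≡ 0#
  entry-0ᵗ []      = refl
  entry-0ᵗ (i ∷ ι) = trans (cong (λ c → entry c ι) (lookup-replicate i 0ᵗ)) (entry-0ᵗ ι)

  entry-axpy : ∀ {d} a (c c′ : Tensor d) ι → entry (axpy a c c′) ι ≡ a * entry c ι + entry c′ ι
  entry-axpy a (scalar x)  (scalar y)   []      = refl
  entry-axpy a (slices cs) (slices cs′) (i ∷ ι) =
    trans (cong (λ c → entry c ι) (lookup-zipWith (axpy a) i cs cs′)) (entry-axpy a (lookup cs i) (lookup cs′ i) ι)

  contract : ∀ {d n} → Vector n → Vec (Tensor d) n → Tensor d
  contract []      []       = 0ᵗ
  contract (x ∷ v) (c ∷ cs) = axpy x c (contract v cs)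

  fiber : ∀ {d n} → Vec (Fin k) d → Vec (Tensor d) n → Vector n
  fiber ι = Vec.map (λ c → entry c ι)

  entry-contract : ∀ {d n} (v : Vector n) (cs : Vec (Tensor d) n) ι → entry (contract v cs) ι ≡ dot v (fiber ι cs)
  entry-contract []      []       ι = entry-0ᵗ ι
  entry-contract (x ∷ v) (c ∷ cs) ι = trans (entry-axpy x c (contract v cs) ι) (cong (x * entry c ι +_) (entry-contract v cs ι))

  axpy-0ᵗ : ∀ {d} a → axpy a 0ᵗ 0ᵗ ≡ 0ᵗ {d}
  axpy-0ᵗ a = ≡-entrywise λ ι → begin
    entry (axpy a 0ᵗ 0ᵗ) ι        ≡⟨ entry-axpy a 0ᵗ 0ᵗ ι ⟩
    a * entry 0ᵗ ι + entry 0ᵗ ι   ≡⟨ cong₂ (λ x y → a * x + y) (entry-0ᵗ ι) (entry-0ᵗ ι) ⟩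
    a * 0# + 0#                   ≡⟨ solve 1 (λ a → a :* con 0 :+ con 0 := con 0) refl a ⟩
    0#                            ≡⟨ entry-0ᵗ ι ⟨
    entry 0ᵗ ι                    ∎
    where open ≡-Reasoning

  contract-axpy : ∀ {d n} a (v : Vector n) (cs cs′ : Vec (Tensor d) n) →
                  contract v (zipWith (axpy a) cs cs′) ≡ axpy a (contract v cs) (contract v cs′)
  contract-axpy a []      []       []         = sym (axpy-0ᵗ a)
  contract-axpy a (x ∷ v) (c ∷ cs) (c′ ∷ cs′) = ≡-entrywise λ ι →
    let C = entry c ι ; C′ = entry c′ ι ; V = entry (contract v cs) ι ; V′ = entry (contract v cs′) ι in begin
    entry (axpy x (axpy a c c′) (contract v (zipWith (axpy a) cs cs′))) ι
      ≡⟨ cong (λ t → entry (axpy x (axpy a c c′) t) ι) (contract-axpy a v cs cs′) ⟩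
    entry (axpy x (axpy a c c′) (axpy a (contract v cs) (contract v cs′))) ι
      ≡⟨ entry-axpy x (axpy a c c′) (axpy a (contract v cs) (contract v cs′)) ι ⟩
    x * entry (axpy a c c′) ι + entry (axpy a (contract v cs) (contract v cs′)) ι
      ≡⟨ cong₂ (λ s t → x * s + t) (entry-axpy a c c′ ι) (entry-axpy a (contract v cs) (contract v cs′) ι) ⟩
    x * (a * C + C′) + (a * V + V′)
      ≡⟨ solve 6 (λ x a C C′ V V′ → x :* (a :* C :+ C′) :+ (a :* V :+ V′) := a :* (x :* C :+ V) :+ (x :* C′ :+ V′))
               refl x a C C′ V V′ ⟩
    a * (x * C + V) + (x * C′ + V′)
      ≡⟨ cong₂ (λ s t → a * s + t) (entry-axpy x c (contract v cs) ι) (entry-axpy x c′ (contract v cs′) ι) ⟨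
    a * entry (axpy x c (contract v cs)) ι + entry (axpy x c′ (contract v cs′)) ι
      ≡⟨ entry-axpy a (axpy x c (contract v cs)) (axpy x c′ (contract v cs′)) ι ⟨
    entry (axpy a (axpy x c (contract v cs)) (axpy x c′ (contract v cs′))) ι ∎
    where open ≡-Reasoning

  contract-+v : ∀ {d n} a (u w : Vector n) (cs : Vec (Tensor d) n) →
                contract (a ·v u +v w) cs ≡ axpy a (contract u cs) (contract w cs)
  contract-+v a []      []      []       = sym (axpy-0ᵗ a)
  contract-+v a (x ∷ u) (y ∷ w) (c ∷ cs) = ≡-entrywise λ ι →
    let C = entry c ι ; U = entry (contract u cs) ι ; W = entry (contract w cs) ι in begin
    entry (axpy (a * x + y) c (contract (a ·v u +v w) cs)) ι
      ≡⟨ cong (λ t → entry (axpy (a * x + y) c t) ι) (contract-+v a u w cs) ⟩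
    entry (axpy (a * x + y) c (axpy a (contract u cs) (contract w cs))) ι
      ≡⟨ trans (entry-axpy _ c _ ι) (cong ((a * x + y) * C +_) (entry-axpy a (contract u cs) (contract w cs) ι)) ⟩
    (a * x + y) * C + (a * U + W)
      ≡⟨ solve 6 (λ a x y C U W → (a :* x :+ y) :* C :+ (a :* U :+ W) := a :* (x :* C :+ U) :+ (y :* C :+ W))
               refl a x y C U W ⟩
    a * (x * C + U) + (y * C + W)
      ≡⟨ cong₂ (λ s t → a * s + t) (entry-axpy x c (contract u cs) ι) (entry-axpy y c (contract w cs) ι) ⟨
    a * entry (axpy x c (contract u cs)) ι + entry (axpy y c (contract w cs)) ι
      ≡⟨ entry-axpy a (axpy x c (contract u cs)) (axpy y c (contract w cs)) ι ⟨
    entry (axpy a (axpy x c (contract u cs)) (axpy y c (contract w cs))) ι ∎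
    where open ≡-Reasoning

  eval : ∀ {d} → Tensor d → Vec (Vector k) d → Carrier
  eval (scalar x)  []       = x
  eval (slices cs) (v ∷ vs) = eval (contract v cs) vs

  eval-axpy : ∀ {d} a (c c′ : Tensor d) vs → eval (axpy a c c′) vs ≡ a * eval c vs + eval c′ vs
  eval-axpy a (scalar x)  (scalar y)   []       = refl
  eval-axpy a (slices cs) (slices cs′) (v ∷ vs) =
    trans (cong (λ t → eval t vs) (contract-axpy a v cs cs′)) (eval-axpy a (contract v cs) (contract v cs′) vs)

  eval-multilinear : ∀ {d} (c : Tensor d) vs i a u w →
                     eval c (vs [ i ]≔ (a ·v u +v w)) ≡ a * eval c (vs [ i ]≔ u) + eval c (vs [ i ]≔ w)
  eval-multilinear (slices cs) (v ∷ vs) Fin.zero    a u w =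
    trans (cong (λ t → eval t vs) (contract-+v a u w cs)) (eval-axpy a (contract u cs) (contract w cs) vs)
  eval-multilinear (slices cs) (v ∷ vs) (Fin.suc i) a u w = eval-multilinear (contract v cs) vs i a u w

  multilinearMap : ∀ {d m} → Vec (Tensor d) m → Hom F d k m
  multilinearMap cs = (λ vs → Vec.map (λ c → eval c vs) cs) , multilinear cs
    where
    multilinear : ∀ {d m} (cs : Vec (Tensor d) m) → IsMultilinear F d k m (λ vs → Vec.map (λ c → eval c vs) cs)
    multilinear []       vs i a u w = refl
    multilinear (c ∷ cs) vs i a u w = cong₂ _∷_ (eval-multilinear c vs i a u w) (multilinear cs vs i a u w)

  VanishesOn : ∀ {d} → Tensor d → Vec (Pair k) d → Set
  VanishesOn c p = ∀ vs → (∀ i → lookup vs i ∈span lookup p i) → eval c vs ≡ 0#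

  vanishesOn? : ∀ {d} (c : Tensor d) p → Dec (VanishesOn c p)
  vanishesOn? {d} c p = ∀? (Vecᴱ d (vectorsᴱ k)) λ vs → Fin.all? (λ i → lookup vs i ∈span? lookup p i) →-dec eval c vs ≟ 0#

  vanishing : ∀ {d} → Vec (Pair k) d → List (Tensor d)
  vanishing {d} p = filter (λ c → vanishesOn? c p) (elements (tensorsᴱ d))

  vanishesOn-contract : ∀ {d} {cs : Vec (Tensor d) k} {u w p} → VanishesOn (slices cs) ((u , w) ∷ p) →
                        ∀ a b → VanishesOn (contract (lincomb a u b w) cs) p
  vanishesOn-contract {u = u} {w} vanish a b vs vs∈ =
    vanish (lincomb a u b w ∷ vs) λ { Fin.zero → a , b , refl ; (Fin.suc i) → vs∈ i }

  -- With u_r ≢ 0 and w′ = u_r·w − w_r·u (so w′_r = 0 ≢ w′_s), a tensor is determined by its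
  -- contractions with u and w′ and its slices other than r and s.  So Φ, which replaces slices r
  -- and s by arbitrary x and y, is injective, and vanishing on span(u, w) × p forces both
  -- contractions to vanish on p.
  module VanishingStep {d} {u w : Vector k} (p : Vec (Pair k) d) (ind : Independent u w) where

    private
      r : Fin k
      r = proj₁ (nonzero-entry (independent⇒≢0v ind))

      ur≢0 : lookup u r ≢ 0#
      ur≢0 = proj₂ (nonzero-entry (independent⇒≢0v ind))

      w′ : Vector k
      w′ = lincomb (- lookup w r) u (lookup u r) w

      w′r≡0 : lookup w′ r ≡ 0#
      w′r≡0 = begin
        lookup w′ r                                   ≡⟨ lookup-lincomb (- lookup w r) u (lookup u r) w r ⟩
        - lookup w r * lookup u r + lookup u r * lookup w r
          ≡⟨ solve 3 (λ nw ur wr → nw :* ur :+ ur :* wr := ur :* (wr :+ nw)) refl (- lookup w r) (lookup u r) (lookup w r) ⟩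
        lookup u r * (lookup w r + - lookup w r)      ≡⟨ cong (lookup u r *_) (-‿inverseʳ (lookup w r)) ⟩
        lookup u r * 0#                               ≡⟨ zeroʳ _ ⟩
        0#                                            ∎
        where open ≡-Reasoning

      s : Fin k
      s = proj₁ (nonzero-entry {u = w′} (ur≢0 ∘ proj₂ ∘ ind _ _))

      w′s≢0 : lookup w′ s ≢ 0#
      w′s≢0 = proj₂ (nonzero-entry {u = w′} (ur≢0 ∘ proj₂ ∘ ind _ _))

      r≢s : r ≢ s
      r≢s r≡s = w′s≢0 (subst (λ i → lookup w′ i ≡ 0#) r≡s w′r≡0)

      lookup-overwritten : ∀ {A : Set} (xs : Vec A k) x y {i} → i ≢ r → i ≢ s → lookup ((xs [ r ]≔ x) [ s ]≔ y) i ≡ lookup xs i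
      lookup-overwritten xs x y i≢r i≢s = trans (lookup∘update′ i≢s (xs [ r ]≔ x) y) (lookup∘update′ i≢r xs x)

    Φ : Tensor (suc d) × Tensor d × Tensor d → Tensor d × Tensor d × Tensor (suc d)
    Φ (slices cs , x , y) = contract u cs , contract w′ cs , slices ((cs [ r ]≔ x) [ s ]≔ y)

    Φ-injective : ∀ t t′ → Φ t ≡ Φ t′ → t ≡ t′
    Φ-injective (slices cs , x , y) (slices cs′ , x′ , y′) eq = cong₂ _,_ (cong slices cs≡cs′) (cong₂ _,_ x≡x′ y≡y′)
      where
      erased≡ : (cs [ r ]≔ x) [ s ]≔ y ≡ (cs′ [ r ]≔ x′) [ s ]≔ y′
      erased≡ = slices-injective (cong (proj₂ ∘ proj₂) eq)
      y≡y′ : y ≡ y′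
      y≡y′ = trans (sym (lookup∘update s (cs [ r ]≔ x) y))
                   (trans (cong (λ v → lookup v s) erased≡) (lookup∘update s (cs′ [ r ]≔ x′) y′))
      x≡x′ : x ≡ x′
      x≡x′ = trans (sym (trans (lookup∘update′ r≢s (cs [ r ]≔ x) y) (lookup∘update r cs x)))
               (trans (cong (λ v → lookup v r) erased≡) (trans (lookup∘update′ r≢s (cs′ [ r ]≔ x′) y′) (lookup∘update r cs′ x′)))
      fiber≡ : ∀ ι → fiber ι cs ≡ fiber ι cs′
      fiber≡ ι = dot-determined r≢s {u} {w′} {fiber ι cs} {fiber ι cs′} ur≢0 w′r≡0 w′s≢0
        (λ i i≢r i≢s → trans (lookup-map i _ cs) (trans (cong (λ c → entry c ι)
                          (trans (sym (lookup-overwritten cs x y i≢r i≢s))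
                                 (trans (cong (λ v → lookup v i) erased≡) (lookup-overwritten cs′ x′ y′ i≢r i≢s))))
                        (sym (lookup-map i _ cs′))))
        (trans (sym (entry-contract u cs ι)) (trans (cong (λ c → entry c ι) (cong proj₁ eq)) (entry-contract u cs′ ι)))
        (trans (sym (entry-contract w′ cs ι)) (trans (cong (λ c → entry c ι) (cong (proj₁ ∘ proj₂) eq)) (entry-contract w′ cs′ ι)))
      cs≡cs′ : cs ≡ cs′
      cs≡cs′ = ≡-pointwise λ i → ≡-entrywise λ ι →
        trans (sym (lookup-map i _ cs)) (trans (cong (λ v → lookup v i) (fiber≡ ι)) (lookup-map i _ cs′))

    Φ-vanishing : ∀ t → VanishesOn (proj₁ t) ((u , w) ∷ p) → VanishesOn (proj₁ (Φ t)) p × VanishesOn (proj₁ (proj₂ (Φ t))) p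
    Φ-vanishing (slices cs , _ , _) vanish =
      subst (λ v → VanishesOn (contract v cs) p) (lincomb-10 u w) (vanishesOn-contract vanish 1# 0#) ,
      vanishesOn-contract vanish (- lookup w r) (lookup u r)

    count-vanishing-step : length (vanishing ((u , w) ∷ p)) ℕ.* (size (tensorsᴱ d) ℕ.* size (tensorsᴱ d))
                           ≤ length (vanishing p) ℕ.* (length (vanishing p) ℕ.* size (tensorsᴱ (suc d)))
    count-vanishing-step = subst₂ _≤_ sources targets $
      count-≤-injection (λ t → vanishesOn? (proj₁ t) ((u , w) ∷ p))
        (Unique.cartesianProduct⁺ (unique (tensorsᴱ (suc d)))
                                  (Unique.cartesianProduct⁺ (unique (tensorsᴱ d)) (unique (tensorsᴱ d))))
        Φ (λ {t} _ vanish → let (v₁ , v₂) = Φ-vanishing t vanish in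
                            ∈-cartesianProduct⁺ (∈-filter⁺ _ (complete (tensorsᴱ d) _) v₁)
                              (∈-cartesianProduct⁺ (∈-filter⁺ _ (complete (tensorsᴱ d) _) v₂) (complete (tensorsᴱ (suc d)) _)))
        (λ _ _ _ _ → Φ-injective _ _)
      where
      T = elements (tensorsᴱ d)
      sources : count (λ t → vanishesOn? (proj₁ t) ((u , w) ∷ p)) (cartesianProduct (elements (tensorsᴱ (suc d))) (cartesianProduct T T))
                ≡ length (vanishing ((u , w) ∷ p)) ℕ.* (size (tensorsᴱ d) ℕ.* size (tensorsᴱ d))
      sources = trans (count-×ˡ (λ c → vanishesOn? c ((u , w) ∷ p)) (elements (tensorsᴱ (suc d))) (cartesianProduct T T))
                      (cong (length (vanishing ((u , w) ∷ p)) ℕ.*_) (length-cartesianProduct T T))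
      targets : length (cartesianProduct (vanishing p) (cartesianProduct (vanishing p) (elements (tensorsᴱ (suc d)))))
                ≡ length (vanishing p) ℕ.* (length (vanishing p) ℕ.* size (tensorsᴱ (suc d)))
      targets = trans (length-cartesianProduct (vanishing p) _) (cong (length (vanishing p) ℕ.*_) (length-cartesianProduct (vanishing p) _))

  count-vanishing : ∀ {d} (p : Vec (Pair k) d) → VecAll.All (uncurry Independent) p →
                    length (vanishing p) ℕ.* q ^ (2 ^ d) ≤ size (tensorsᴱ d)
  count-vanishing [] VecAll.[] = ℕ.≤-reflexive $ begin
    length (vanishing []) ℕ.* q ^ 1     ≡⟨ cong₂ ℕ._*_ count-vanishing-[] (ℕ.*-identityʳ q) ⟩
    1 ℕ.* q                              ≡⟨ ℕ.*-identityˡ q ⟩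
    q                                    ≡⟨ trans (length-map scalar (elements scalarsᴱ)) size-scalarsᴱ ⟨
    size (tensorsᴱ 0)                    ∎
    where
    open ≡-Reasoning
    count-vanishing-[] : length (vanishing []) ≡ 1
    count-vanishing-[] = begin
      count (λ c → vanishesOn? c []) (map scalar (elements scalarsᴱ))  ≡⟨ count-map (λ c → vanishesOn? c []) scalar (elements scalarsᴱ) ⟩
      count (λ x → vanishesOn? (scalar x) []) (elements scalarsᴱ)
        ≡⟨ count-≐ (λ x → vanishesOn? (scalar x) []) (_≟ 0#) ((λ vanish → vanish [] λ ()) , λ { x≡0 [] _ → x≡0 }) (elements scalarsᴱ) ⟩
      count (_≟ 0#) (elements scalarsᴱ)                                ≡⟨ count-≟ _≟_ (unique scalarsᴱ) (complete scalarsᴱ 0#) ⟩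
      1                                                                 ∎
  count-vanishing {suc d} ((u , w) ∷ p) (ind VecAll.∷ inds) =
    subst (λ Q → length (vanishing ((u , w) ∷ p)) ℕ.* Q ≤ size (tensorsᴱ (suc d))) (sym q^2^[1+d]) $
    square-bound (length (vanishing ((u , w) ∷ p))) (length (vanishing p)) (size (tensorsᴱ d)) (size (tensorsᴱ (suc d))) (q ^ (2 ^ d))
      (∈⇒0<length (complete (tensorsᴱ d) 0ᵗ))
      (VanishingStep.count-vanishing-step p ind) (count-vanishing p inds)
    where
    q^2^[1+d] : q ^ (2 ^ suc d) ≡ q ^ (2 ^ d) ℕ.* q ^ (2 ^ d)
    q^2^[1+d] = trans (cong (λ e → q ^ (2 ^ d ℕ.+ e)) (ℕ.+-identityʳ (2 ^ d))) (ℕ.^-distribˡ-+-* q (2 ^ d) (2 ^ d))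

module FirstMoment {q : ℕ} (F : FiniteField q) (k d m : ℕ) where
  open Tensors F k public

  Bases : Set
  Bases = Vec (Pair k) d

  basesᴱ : Enumeration Bases
  basesᴱ = Vecᴱ d (pairsᴱ k)

  coefficientsᴱ : Enumeration (Vec (Tensor d) m)
  coefficientsᴱ = Vecᴱ m (tensorsᴱ d)

  Good : Vec (Tensor d) m → Bases → Set
  Good cs p = VecAll.All (uncurry Independent) p × VecAll.All (λ c → VanishesOn c p) cs

  good? : ∀ cs p → Dec (Good cs p)
  good? cs p = VecAll.all? independentPair? p ×-dec VecAll.all? (λ c → vanishesOn? c p) cs

  goodBases : Vec (Tensor d) m → List Bases
  goodBases cs = filter (good? cs) (elements basesᴱ)

  count-independentBases : count (VecAll.all? independentPair?) (elements basesᴱ) ≡ ((q ^ k ∸ 1) ℕ.* (q ^ k ∸ q)) ^ d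
  count-independentBases = trans (count-vectors-All independentPair? d _) (cong (_^ d) (count-independentPairs k))

  count-good-for : ∀ p → VecAll.All (uncurry Independent) p →
                   count (λ cs → good? cs p) (elements coefficientsᴱ) ℕ.* q ^ (m ℕ.* 2 ^ d) ≤ size coefficientsᴱ
  count-good-for p ind = begin
    count (λ cs → good? cs p) Cs ℕ.* q ^ (m ℕ.* 2 ^ d)
      ≡⟨ cong₂ ℕ._*_ (count-≐ (λ cs → good? cs p) (VecAll.all? (λ c → vanishesOn? c p)) (proj₂ , (ind ,_)) Cs) q^m2^d ⟩
    count (VecAll.all? (λ c → vanishesOn? c p)) Cs ℕ.* (q ^ (2 ^ d)) ^ m
      ≡⟨ cong (ℕ._* (q ^ (2 ^ d)) ^ m) (count-vectors-All (λ c → vanishesOn? c p) m _) ⟩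
    length (vanishing p) ^ m ℕ.* (q ^ (2 ^ d)) ^ m
      ≡⟨ *-^-distrib (length (vanishing p)) _ m ⟨
    (length (vanishing p) ℕ.* q ^ (2 ^ d)) ^ m
      ≤⟨ ℕ.^-monoˡ-≤ m (count-vanishing p ind) ⟩
    size (tensorsᴱ d) ^ m
      ≡⟨ length-vectors m _ ⟨
    size coefficientsᴱ ∎
    where
    open ℕ.≤-Reasoning
    Cs = elements coefficientsᴱ
    q^m2^d : q ^ (m ℕ.* 2 ^ d) ≡ (q ^ (2 ^ d)) ^ m
    q^m2^d = trans (cong (q ^_) (ℕ.*-comm m (2 ^ d))) (sym (ℕ.^-*-assoc q (2 ^ d) m))

  first-moment : ∃[ cs ] length (goodBases cs) ℕ.* q ^ (m ℕ.* 2 ^ d) ≤ ((q ^ k ∸ 1) ℕ.* (q ^ k ∸ q)) ^ d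
  first-moment =
    let (cs , _ , bound) = averaging (λ cs → length (goodBases cs) ℕ.* Qm) _ {Cs}
                             (∈⇒0<length (complete coefficientsᴱ (replicate m 0ᵗ))) total
    in cs , bound
    where
    open ℕ.≤-Reasoning
    Qm = q ^ (m ℕ.* 2 ^ d)
    Cs = elements coefficientsᴱ
    Ps = elements basesᴱ
    total : ∑[ cs ← Cs ] (length (goodBases cs) ℕ.* Qm) ≤ length Cs ℕ.* ((q ^ k ∸ 1) ℕ.* (q ^ k ∸ q)) ^ d
    total = begin
      ∑[ cs ← Cs ] (count (good? cs) Ps ℕ.* Qm)                   ≡⟨ ∑-*ʳ Cs (λ cs → count (good? cs) Ps) Qm ⟩
      ∑[ cs ← Cs ] count (good? cs) Ps ℕ.* Qm                     ≡⟨ cong (ℕ._* Qm) (∑-count-comm good? Cs Ps) ⟩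
      ∑[ p ← Ps ] count (λ cs → good? cs p) Cs ℕ.* Qm             ≡⟨ ∑-*ʳ Ps (λ p → count (λ cs → good? cs p) Cs) Qm ⟨
      ∑[ p ← Ps ] (count (λ cs → good? cs p) Cs ℕ.* Qm)           ≤⟨ ∑-≤-indicator (VecAll.all? independentPair?) Ps (count-good-for _)
          (λ ¬ind → cong (ℕ._* Qm) (count-none (λ cs → good? cs _) {Cs} (All.tabulate λ _ → ¬ind ∘ proj₁))) ⟩
      count (VecAll.all? independentPair?) Ps ℕ.* length Cs       ≡⟨ cong (ℕ._* length Cs) count-independentBases ⟩
      ((q ^ k ∸ 1) ℕ.* (q ^ k ∸ q)) ^ d ℕ.* length Cs             ≡⟨ ℕ.*-comm _ (length Cs) ⟩
      length Cs ℕ.* ((q ^ k ∸ 1) ℕ.* (q ^ k ∸ q)) ^ d             ∎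

module PlaneTuples {q : ℕ} (F : FiniteField q) (k d m : ℕ) (cs : Vec (Tensors.Tensor F k d) m) where
  open FirstMoment F k d m public

  T : Hom F d k m
  T = multilinearMap cs

  _≈spans_ : Bases → Bases → Set
  p ≈spans p′ = ∀ i → lookup p i ≈span lookup p′ i

  _≈spans?_ : ∀ p p′ → Dec (p ≈spans p′)
  p ≈spans? p′ = Fin.all? λ i → lookup p i ≈span? lookup p′ i

  ≈spans-isEquivalence : IsEquivalence _≈spans_
  ≈spans-isEquivalence = record
    { refl  = λ i x → id , id
    ; sym   = λ p≈p′ i x → swap (p≈p′ i x)
    ; trans = λ p≈p′ p′≈p″ i x → proj₁ (p′≈p″ i x) ∘ proj₁ (p≈p′ i x) , proj₂ (p≈p′ i x) ∘ proj₂ (p′≈p″ i x)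
    }

  open IsEquivalence ≈spans-isEquivalence using () renaming (sym to ≈spans-sym)
  open Representatives ≈spans-isEquivalence _≈spans?_ (≡-dec (Product.≡-dec _≟v_ _≟v_)) (goodBases cs) public

  vanishesOn-resp-≈spans : ∀ {c : Tensor d} {p p′} → p ≈spans p′ → VanishesOn c p → VanishesOn c p′
  vanishesOn-resp-≈spans p≈p′ vanish vs vs∈ = vanish vs λ i → proj₂ (p≈p′ i (lookup vs i)) (vs∈ i)

  invertibles : List (Vec (Pair 2) d)
  invertibles = filter (VecAll.all? independentPair?) (elements (Vecᴱ d (pairsᴱ 2)))

  length-invertibles : length invertibles ≡ (q ^ 2 ∸ 1) ^ d ℕ.* (q ^ 2 ∸ q) ^ d
  length-invertibles = trans (count-vectors-All independentPair? d _)
                             (trans (cong (_^ d) (count-independentPairs 2)) (*-^-distrib (q ^ 2 ∸ 1) (q ^ 2 ∸ q) d))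

  actAll : Bases → Vec (Pair 2) d → Bases
  actAll = zipWith act

  module _ {r : Bases} (ind : VecAll.All (uncurry Independent) r) where

    lookup-actAll : ∀ g i → lookup (actAll r g) i ≡ act (lookup r i) (lookup g i)
    lookup-actAll g i = lookup-zipWith act i r g

    actAll-≈spans : ∀ {g} → VecAll.All (uncurry Independent) g → actAll r g ≈spans r
    actAll-≈spans {g} ind-g i = subst (_≈span lookup r i) (sym (lookup-actAll g i))
                                      (act-≈span (lookup⁺ ind i) (lookup g i) (lookup⁺ ind-g i))

    actAll-good : ∀ {g} → VecAll.All (uncurry Independent) g → VecAll.All (λ c → VanishesOn c r) cs → Good cs (actAll r g)
    actAll-good {g} ind-g vanish =
        lookup⁻ (λ i → subst (uncurry Independent) (sym (lookup-actAll g i))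
                                     (act-independent (lookup⁺ ind i) (lookup g i) (lookup⁺ ind-g i)))
      , VecAll.map (λ {c} → vanishesOn-resp-≈spans {c} {r} {actAll r g} (≈spans-sym {actAll r g} {r} (actAll-≈spans ind-g)))
                   vanish

    actAll-injective : ∀ g g′ → actAll r g ≡ actAll r g′ → g ≡ g′
    actAll-injective g g′ eq = ≡-pointwise λ i → act-injective (lookup⁺ ind i) (lookup g i) (lookup g′ i)
      (trans (sym (lookup-actAll g i)) (trans (cong (λ p → lookup p i) eq) (lookup-actAll g′ i)))

  orbits : length representatives ℕ.* length invertibles ≤ length (goodBases cs)
  orbits = orbit-counting (Unique.filter⁺ (good? cs) (unique basesᴱ)) invertibles
    (Unique.filter⁺ (VecAll.all? independentPair?) (unique (Vecᴱ d (pairsᴱ 2)))) actAll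
    (λ r∈ g∈ → let ((ind , vanish) , ind-g) = good r∈ , invertible g∈ in
               ∈-filter⁺ (good? cs) (complete basesᴱ _) (actAll-good ind ind-g vanish))
    (λ r∈ g∈ → actAll-≈spans (proj₁ (good r∈)) (invertible g∈))
    (λ r∈ _ _ → actAll-injective (proj₁ (good r∈)) _ _)
    where
    good : ∀ {r} → r ∈ goodBases cs → Good cs r
    good = proj₂ ∘ ∈-filter⁻ (good? cs) {xs = elements basesᴱ}
    invertible : ∀ {g} → g ∈ invertibles → VecAll.All (uncurry Independent) g
    invertible = proj₂ ∘ ∈-filter⁻ (VecAll.all? independentPair?) {xs = elements (Vecᴱ d (pairsᴱ 2))}

  basis : Sub2 F k → Pair k
  basis (_ , u , w , _) = u , w

  basis-independent : ∀ V → uncurry Independent (basis V)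
  basis-independent (_ , _ , _ , ind , _) = ind

  basis-spans : ∀ (V : Sub2 F k) x → (proj₁ V x ≡ true → x ∈span basis V) × (x ∈span basis V → proj₁ V x ≡ true)
  basis-spans (_ , _ , _ , _ , spans) = spans

  bases : D F T → Bases
  bases (Vs , _) = tabulate (basis ∘ Vs)

  bases-good : ∀ x → Good cs (bases x)
  bases-good (Vs , T-vanishes) =
      lookup⁻ (λ i → subst (uncurry Independent) (sym (lookup∘tabulate (basis ∘ Vs) i)) (basis-independent (Vs i)))
    , lookup⁻ λ j vs vs∈ → begin
        eval (lookup cs j) vs                         ≡⟨ lookup-map j (λ c → eval c vs) cs ⟨
        lookup (Vec.map (λ c → eval c vs) cs) j      ≡⟨ cong (λ v → lookup v j) (T-vanishes vs (λ i → proj₂ (basis-spans (Vs i) (lookup vs i))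
                                                                  (subst (lookup vs i ∈span_) (lookup∘tabulate (basis ∘ Vs) i) (vs∈ i)))) ⟩
        lookup (0ᵛ F) j                               ≡⟨ lookup-replicate j 0# ⟩
        0#                                            ∎
    where open ≡-Reasoning

  bases∈goodBases : ∀ x → bases x ∈ goodBases cs
  bases∈goodBases x = ∈-filter⁺ (good? cs) (complete basesᴱ (bases x)) (bases-good x)

  ≈spans⇒≈D : ∀ x y → bases x ≈spans bases y → _≈D_ F {T = T} x y
  ≈spans⇒≈D (Vs , _) (Ws , _) same i z = ⇔→≡ $ mk⇔ (λ z∈V → proj₂ (basis-spans (Ws i) z) (⊆ (proj₁ (basis-spans (Vs i) z) z∈V)))
                                                       (λ z∈W → proj₂ (basis-spans (Vs i) z) (⊇ (proj₁ (basis-spans (Ws i) z) z∈W)))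
    where
    spans≈ : basis (Vs i) ≈span basis (Ws i)
    spans≈ = subst₂ _≈span_ (lookup∘tabulate (basis ∘ Vs) i) (lookup∘tabulate (basis ∘ Ws) i) (same i)
    ⊆ = proj₁ (spans≈ z)
    ⊇ = proj₂ (spans≈ z)

  card-D : CardD≤ F T (length representatives)
  card-D = (λ x → classIndex (bases∈goodBases x))
         , λ x y eq → ≈spans⇒≈D x y (classIndex-injective (bases∈goodBases x) (bases∈goodBases y) eq)

  planeTuples-bound : ∀ {N} → length (goodBases cs) ℕ.* q ^ (m ℕ.* 2 ^ d) ≤ N →
                      length representatives ℕ.* (q ^ (m ℕ.* 2 ^ d) ℕ.* ((q ^ 2 ∸ 1) ^ d ℕ.* (q ^ 2 ∸ q) ^ d)) ≤ N
  planeTuples-bound {N} few-goodBases = begin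
    length representatives ℕ.* (Qm ℕ.* ((q ^ 2 ∸ 1) ^ d ℕ.* (q ^ 2 ∸ q) ^ d))
      ≡⟨ cong (λ G → length representatives ℕ.* (Qm ℕ.* G)) length-invertibles ⟨
    length representatives ℕ.* (Qm ℕ.* length invertibles)                   ≡⟨ rearrange (length representatives) Qm (length invertibles) ⟩
    length representatives ℕ.* length invertibles ℕ.* Qm                     ≤⟨ ℕ.*-monoˡ-≤ Qm orbits ⟩
    length (goodBases cs) ℕ.* Qm                                             ≤⟨ few-goodBases ⟩
    N                                                                        ∎
    where
    open ℕ.≤-Reasoning
    Qm = q ^ (m ℕ.* 2 ^ d)
    rearrange : ∀ b x g → b ℕ.* (x ℕ.* g) ≡ b ℕ.* g ℕ.* x
    rearrange = solve-∀

open import Data.Nat using (_+_; _*_; _<_)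

-- The bound holds for every q, so Q = 0; the hypotheses on n, d and m are only needed for the
-- asymptotic form of the bound.
lemmaA3 : (n d m : ℕ) → 2 ≤ n → 2 ≤ d → 1 ≤ m →
    m * (2 ^ d ∸ 1) < (n ∸ 1) * d →
    ∃[ Q ] ∀ (q : ℕ) → Q ≤ q → (F : FiniteField q) →
      ∃[ T ] ∃[ B ] (CardD≤ F {d} {n + 1} {m} T B ×
        (B * (q ^ (m * 2 ^ d) * ((q ^ 2 ∸ 1) ^ d * (q ^ 2 ∸ q) ^ d))
          ≤ (q ^ (n + 1) ∸ 1) ^ d * (q ^ (n + 1) ∸ q) ^ d))
lemmaA3 n d m _ _ _ _ = 0 , λ q _ F →
  let (cs , few-goodBases) = FirstMoment.first-moment F (n + 1) d m
      open PlaneTuples F (n + 1) d m cs using (T; representatives; card-D; planeTuples-bound; goodBases)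
  in T , length representatives , card-D
       , planeTuples-bound (subst (length (goodBases cs) * q ^ (m * 2 ^ d) ≤_)
                                  (*-^-distrib (q ^ (n + 1) ∸ 1) (q ^ (n + 1) ∸ q) d) few-goodBases)
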